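{- Let $a\in\mathbb{Z}_{+}$, let $n,\ell_X,\ell_Y$ be positive integers with $a\ge n$, let $\ell=\ell_X+\ell_Y$, and let $(X_1,Y_1),\ldots,(X_n,Y_n)\in\Sigma^{\ell_X}\times\Sigma^{\ell_Y}$. Let $\mathtt{A},\mathtt{B},\mathtt{C},\mathtt{D}$ be four distinct characters not in $\Sigma$, and define $X=\mathtt{A}^{\ell_Y}\cdot\bigodot_{j=1}^n(\mathtt{B}^{\ell}\cdot X_j\cdot\mathtt{C}^{\ell}\cdot\mathtt{A}^{\ell_Y})$ and $Y=Y_1\cdot\bigodot_{j=2}^n(\mathtt{B}^{\ell}\cdot\mathtt{D}^{\ell_X}\cdot\mathtt{C}^{\ell}\cdot Y_j)$. Then $D_a(X,Y)=\frac{(n-1)\ell}{a}+\min_{i=1}^n D^+_a(X_i,Y_i)$.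
   Context: $\bigodot$ and $\cdot$ denote concatenation and $c^m$ denotes $m$ copies of character $c$. For $a\ge1$, $\mathtt{ED}_a(X,Y)$ is the minimum total cost of edit operations transforming $X$ into $Y$, where insertions and deletions cost $1$ and substitutions cost $\frac1a$. $D_a(X,Y)=\mathtt{ED}_a(X,Y)+|Y|-|X|$, and $D^+_a(X,Y)=D_a(\$^{|Y|}\cdot X\cdot\$^{|Y|},Y)$ where $\$$ is a fresh character not in $\Sigma$. -}

module Defs where

open import Data.Nat as ℕ using (ℕ; zero; suc; NonZero)
open import Data.Integer as ℤ using (ℤ; +_)
open import Data.Rational using (ℚ; _/_; _+_; _-_; _⊓_; 0ℚ; 1ℚ)
open import Data.Fin using (Fin; zero; suc)
open import Data.List using (List; []; _∷_; length; replicate; map; concat; tabulate; _++_)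
open import Data.Vec using (Vec; toList)
open import Relation.Nullary using (yes; no)
open import Relation.Binary.Definitions using (DecidableEquality)
open import Relation.Binary.PropositionalEquality using (_≡_; refl)

module _ {S : Set} (_≟_ : DecidableEquality S) (a : ℕ) .{{_ : NonZero a}} where

  subCost : S → S → ℚ
  subCost x y with x ≟ y
  ... | yes _ = 0ℚ
  ... | no _  = + 1 / a

  ED : List S → List S → ℚ
  ED []       ys       = + length ys / 1
  ED (x ∷ xs) []       = + length (x ∷ xs) / 1
  ED (x ∷ xs) (y ∷ ys) =
    (ED xs ys + subCost x y) ⊓ ((ED xs (y ∷ ys) + 1ℚ) ⊓ (ED (x ∷ xs) ys + 1ℚ))

  Dₐ : List S → List S → ℚ
  Dₐ X Y = ED X Y + ((+ length Y ℤ.- + length X) / 1)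

data Ext (Σ : Set) : Set where
  chA chB chC chD dollar : Ext Σ
  sym : Σ → Ext Σ

module _ {Σ : Set} (_≟_ : DecidableEquality Σ) where

  _≟E_ : DecidableEquality (Ext Σ)
  chA ≟E chA = yes refl
  chA ≟E chB = no λ ()
  chA ≟E chC = no λ ()
  chA ≟E chD = no λ ()
  chA ≟E dollar = no λ ()
  chA ≟E sym _ = no λ ()
  chB ≟E chA = no λ ()
  chB ≟E chB = yes refl
  chB ≟E chC = no λ ()
  chB ≟E chD = no λ ()
  chB ≟E dollar = no λ ()
  chB ≟E sym _ = no λ ()
  chC ≟E chA = no λ ()
  chC ≟E chB = no λ ()
  chC ≟E chC = yes refl
  chC ≟E chD = no λ ()
  chC ≟E dollar = no λ ()
  chC ≟E sym _ = no λ ()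
  chD ≟E chA = no λ ()
  chD ≟E chB = no λ ()
  chD ≟E chC = no λ ()
  chD ≟E chD = yes refl
  chD ≟E dollar = no λ ()
  chD ≟E sym _ = no λ ()
  dollar ≟E chA = no λ ()
  dollar ≟E chB = no λ ()
  dollar ≟E chC = no λ ()
  dollar ≟E chD = no λ ()
  dollar ≟E dollar = yes refl
  dollar ≟E sym _ = no λ ()
  sym _ ≟E chA = no λ ()
  sym _ ≟E chB = no λ ()
  sym _ ≟E chC = no λ ()
  sym _ ≟E chD = no λ ()
  sym _ ≟E dollar = no λ ()
  sym x ≟E sym y with x ≟ y
  ... | yes refl = yes refl
  ... | no ne = no λ { refl → ne refl }

  emb : List Σ → List (Ext Σ)
  emb = map sym

  DₐE : (a : ℕ) .{{_ : NonZero a}} → List (Ext Σ) → List (Ext Σ) → ℚ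
  DₐE a = Dₐ _≟E_ a

  D⁺ : (a : ℕ) .{{_ : NonZero a}} → List Σ → List Σ → ℚ
  D⁺ a X Y = DₐE a (replicate (length Y) dollar ++ emb X ++ replicate (length Y) dollar) (emb Y)

minFin : ∀ {m} → (Fin (suc m) → ℚ) → ℚ
minFin {zero}  f = f zero
minFin {suc m} f = f zero ⊓ minFin (λ i → f (suc i))

-- The construction, for n = suc m
module Construction {Σ : Set} (m ℓX ℓY : ℕ)
  (Xs : Fin (suc m) → Vec Σ ℓX) (Ys : Fin (suc m) → Vec Σ ℓY) where

  ℓ : ℕ
  ℓ = ℓX ℕ.+ ℓY

  bigX : List (Ext Σ)
  bigX = replicate ℓY chA ++ concat (tabulate λ j →
           replicate ℓ chB ++ map sym (toList (Xs j)) ++ replicate ℓ chC ++ replicate ℓY chA)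

  bigY : List (Ext Σ)
  bigY = map sym (toList (Ys zero)) ++ concat (tabulate λ (k : Fin m) →
           replicate ℓ chB ++ replicate ℓX chD ++ replicate ℓ chC ++ map sym (toList (Ys (suc k))))

{-# OPTIONS --safe #-}
module Submission where

-- Multiplying by a turns D_a into the integer cost dist below: deletions are free, substitutions
-- cost 1 and insertions 2a.
--
-- Upper bound: fix i. Gadget j is matched against B^ℓ X_j C^ℓ for j < i and against
-- B^ℓ X_{j+1} C^ℓ for j ≥ i, paying ℓX for its D's, and every Y_j with j ≠ i is substituted by an
-- A-run, paying ℓY; Y_i is matched inside A^ℓY B^ℓ X_i C^ℓ A^ℓY, which costs no more than its
-- $-padding, i.e. D⁺(X_i, Y_i).
--
-- Lower bound: C^ℓ · X · B^ℓ is the concatenation of the units X_j C^ℓ A^ℓY B^ℓ, j = 0..n, with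
-- X_0 empty. Cutting Y in front of its k-th gadget and X correspondingly, the cut lies inside one
-- unit, so the gadget and the Y-block after it are paid for by a window of consecutive units:
-- a window of one unit costs at least ℓ + ℓY, of two units ℓ, of three units ℓX + min(ℓY, D⁺(X′, Y′))
-- for its last block X′ and that Y-block Y′, and any window ℓX, as X has no D. By induction on k,
-- the first u + 1 units against the first k + 1 blocks of Y cost at least k(ℓ + ℓY) + ℓY − uℓY,
-- plus M = min D⁺ when k < u; at k = n − 1 and u = n this is (n − 1)ℓ + M.

open import Defs

module ScaledDistance where

  open import Data.Bool using (Bool; true; false; if_then_else_; _∨_)
  open import Data.Empty using (⊥-elim)
  open import Data.Fin using (Fin; zero; suc; toℕ)
  open import Data.Fin.Properties using (toℕ-injective; toℕ-fromℕ<; toℕ<n)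
  import Data.Integer as ℤ
  import Data.Integer.Properties as ℤₚ
  open import Data.Integer.Tactic.RingSolver using () renaming (solve-∀ to ℤ-solve-∀)
  open import Data.List using (List; []; _∷_; _++_; length; replicate; map; concat; tabulate)
  open import Data.List.Properties
    using (++-identityʳ; ++-assoc; ∷-injective; ++-cancelʳ; ++-monoid; length-replicate; length-map; length-++)
  open import Data.List.Relation.Unary.All as All using (All; []; _∷_)
  import Data.List.Relation.Unary.All.Properties as Allₚ
  open import Data.Nat using (ℕ; zero; suc; pred; _+_; _*_; _≤_; _<_; _⊓_; z≤n; s≤s; s≤s⁻¹)
  open import Data.Nat.DivMod using (_mod_; m<n⇒m%n≡m)
  open import Data.Nat.Properties
  open import Algebra.Properties.CommutativeSemigroup +-commutativeSemigroup using (xy∙z≈xz∙y)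
  open import Data.Nat.Tactic.RingSolver using (solve-∀)
  open import Data.Product using (Σ-syntax; _×_; _,_)
  open import Data.Rational as ℚ using (ℚ; _/_; 0ℚ; 1ℚ)
  import Data.Rational.Properties as ℚₚ
  open import Data.Rational.Unnormalised as ℚᵘ using (mkℚᵘ; *≡*; *≤*)
  import Data.Rational.Unnormalised.Properties as ℚᵘₚ
  open import Data.Sum using (_⊎_; inj₁; inj₂)
  open import Data.Vec using (Vec; toList)
  open import Data.Vec.Properties using (length-toList)
  open import Function using (_∘_)
  open import Relation.Binary.Definitions using (DecidableEquality)
  open import Relation.Binary.PropositionalEquality as ≡ hiding (sym)
  open import Relation.Nullary using (yes; no)

  ⊓₃-glb : ∀ {n p q r} → n ≤ p → n ≤ q → n ≤ r → n ≤ p ⊓ (q ⊓ r)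
  ⊓₃-glb p q r = ⊓-glb p (⊓-glb q r)

  +-distribʳ-⊓₃ : ∀ r p q s → (p ⊓ (q ⊓ s)) + r ≡ (p + r) ⊓ ((q + r) ⊓ (s + r))
  +-distribʳ-⊓₃ r p q s = trans (+-distribʳ-⊓ r p (q ⊓ s)) (cong ((p + r) ⊓_) (+-distribʳ-⊓ r q s))

  add-bounds : ∀ {p q d₁ d₂ d a b c} → p ≤ d₁ + a * c → q ≤ d₂ + b * c → d₁ + d₂ ≤ d →
               q + p ≤ d + (a + b) * c
  add-bounds {p} {q} {d₁} {d₂} {d} {a} {b} {c} p≤ q≤ d₁+d₂≤d = begin
    q + p                         ≤⟨ +-mono-≤ q≤ p≤ ⟩
    d₂ + b * c + (d₁ + a * c)     ≡⟨ regroup d₁ d₂ a b c ⟩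
    d₁ + d₂ + (a + b) * c         ≤⟨ +-monoˡ-≤ _ d₁+d₂≤d ⟩
    d + (a + b) * c               ∎
    where
    open ≤-Reasoning
    regroup : ∀ d₁ d₂ a b c → d₂ + b * c + (d₁ + a * c) ≡ d₁ + d₂ + (a + b) * c
    regroup = solve-∀

  suc<+suc : ∀ k a b → suc k < a + suc b → k < a + b
  suc<+suc k a b h = s≤s⁻¹ (subst (suc (suc k) ≤_) (+-suc a b) h)

  minℕ : ∀ {m} → (Fin (suc m) → ℕ) → ℕ
  minℕ {zero}  f = f zero
  minℕ {suc m} f = f zero ⊓ minℕ (f ∘ suc)

  minℕ-≤ : ∀ {m} (f : Fin (suc m) → ℕ) i → minℕ f ≤ f i
  minℕ-≤ {zero}  f zero    = ≤-refl
  minℕ-≤ {suc m} f zero    = m⊓n≤m _ _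
  minℕ-≤ {suc m} f (suc i) = ≤-trans (m⊓n≤n _ _) (minℕ-≤ (f ∘ suc) i)

  minℕ-attained : ∀ {m} (f : Fin (suc m) → ℕ) → Σ[ i ∈ Fin (suc m) ] minℕ f ≡ f i
  minℕ-attained {zero}  f = zero , refl
  minℕ-attained {suc m} f with ⊓-sel (f zero) (minℕ (f ∘ suc))
  ... | inj₁ e = zero , e
  ... | inj₂ e with minℕ-attained (f ∘ suc)
  ...   | i , e′ = suc i , trans e e′

  toℕ-mod : ∀ {n} (j : Fin (suc n)) → toℕ j mod suc n ≡ j
  toℕ-mod j = toℕ-injective (trans (toℕ-fromℕ< _) (m<n⇒m%n≡m (toℕ<n j)))

  module _ {A : Set} where

    count : (A → Bool) → List A → ℕ
    count P []       = 0
    count P (x ∷ xs) = if P x then suc (count P xs) else count P xs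

    Avoids : (A → Bool) → List A → Set
    Avoids P = All (λ x → P x ≡ false)

    count-∷-≤ : ∀ P x xs → count P (x ∷ xs) ≤ suc (count P xs)
    count-∷-≤ P x xs with P x
    ... | true  = ≤-refl
    ... | false = n≤1+n _

    count-++ : ∀ P xs ys → count P (xs ++ ys) ≡ count P xs + count P ys
    count-++ P []       ys = refl
    count-++ P (x ∷ xs) ys with P x
    ... | true  = cong suc (count-++ P xs ys)
    ... | false = count-++ P xs ys

    count-replicate : ∀ {P x} k → P x ≡ true → count P (replicate k x) ≡ k
    count-replicate zero    px = refl
    count-replicate (suc k) px rewrite px = cong suc (count-replicate k px)

    count-++ˡ-≤ : ∀ P xs ys → count P xs ≤ count P (xs ++ ys)
    count-++ˡ-≤ P xs ys = ≤-trans (m≤m+n _ _) (≤-reflexive (≡.sym (count-++ P xs ys)))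

    count-++ʳ-≤ : ∀ P xs ys → count P ys ≤ count P (xs ++ ys)
    count-++ʳ-≤ P xs ys = ≤-trans (m≤n+m _ _) (≤-reflexive (≡.sym (count-++ P xs ys)))

    count-all : ∀ {P xs} → All (λ x → P x ≡ true) xs → count P xs ≡ length xs
    count-all []         = refl
    count-all (px ∷ all) rewrite px = cong suc (count-all all)

    prefix-avoids : ∀ {P S W L} → S ++ W ≡ L → Avoids P L → Avoids P S
    prefix-avoids {S = S} refl avoid = Allₚ.++⁻ˡ S avoid

    suffix-avoids : ∀ {P S W L} → W ++ S ≡ L → Avoids P L → Avoids P S
    suffix-avoids {W = W} refl avoid = Allₚ.++⁻ʳ W avoid

    avoids-∨ : ∀ {P Q S} → Avoids P S → Avoids Q S → Avoids (λ x → P x ∨ Q x) S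
    avoids-∨ p q = All.zipWith (λ (px , qx) → cong₂ _∨_ px qx) (p , q)

  module Distance {E : Set} (_≟_ : DecidableEquality E) (ι : ℕ) where

    mismatch : E → E → ℕ
    mismatch x y with x ≟ y
    ... | yes _ = 0
    ... | no _  = 1

    dist : List E → List E → ℕ
    dist xs       []       = 0
    dist []       (y ∷ ys) = ι + dist [] ys
    dist (x ∷ xs) (y ∷ ys) =
      (dist xs ys + mismatch x y) ⊓ (dist xs (y ∷ ys) ⊓ (dist (x ∷ xs) ys + ι))

    mismatch-self : ∀ x → mismatch x x ≡ 0
    mismatch-self x with x ≟ x
    ... | yes _ = refl
    ... | no x≢x = ⊥-elim (x≢x refl)

    mismatch≤1 : ∀ x y → mismatch x y ≤ 1
    mismatch≤1 x y with x ≟ y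
    ... | yes _ = z≤n
    ... | no _  = s≤s z≤n

    dist-sub : ∀ x xs y ys → dist (x ∷ xs) (y ∷ ys) ≤ dist xs ys + mismatch x y
    dist-sub x xs y ys = m⊓n≤m _ _

    dist-del : ∀ x xs ys → dist (x ∷ xs) ys ≤ dist xs ys
    dist-del x xs []       = z≤n
    dist-del x xs (y ∷ ys) = ≤-trans (m⊓n≤n _ _) (m⊓n≤m _ _)

    dist-ins : ∀ xs y ys → dist xs (y ∷ ys) ≤ dist xs ys + ι
    dist-ins []       y ys = ≤-reflexive (+-comm ι _)
    dist-ins (x ∷ xs) y ys = ≤-trans (m⊓n≤n _ _) (m⊓n≤n _ _)

    data FirstMove (x : E) (xs : List E) (y : E) (ys : List E) : Set where
      substitution : dist (x ∷ xs) (y ∷ ys) ≡ dist xs ys + mismatch x y → FirstMove x xs y ys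
      deletion     : dist (x ∷ xs) (y ∷ ys) ≡ dist xs (y ∷ ys) → FirstMove x xs y ys
      insertion    : dist (x ∷ xs) (y ∷ ys) ≡ dist (x ∷ xs) ys + ι → FirstMove x xs y ys

    first-move : ∀ x xs y ys → FirstMove x xs y ys
    first-move x xs y ys with ⊓-sel (dist xs ys + mismatch x y) (dist xs (y ∷ ys) ⊓ (dist (x ∷ xs) ys + ι))
    ... | inj₁ e = substitution e
    ... | inj₂ e with ⊓-sel (dist xs (y ∷ ys)) (dist (x ∷ xs) ys + ι)
    ...   | inj₁ e′ = deletion (trans e e′)
    ...   | inj₂ e′ = insertion (trans e e′)

    dist-[]ˡ : ∀ T → dist [] T ≡ ι * length T
    dist-[]ˡ []      = ≡.sym (*-zeroʳ ι)
    dist-[]ˡ (y ∷ T) = trans (cong (ι +_) (dist-[]ˡ T)) (≡.sym (*-suc ι (length T)))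

    dist-[]-++ : ∀ T₁ T₂ → dist [] (T₁ ++ T₂) ≡ dist [] T₁ + dist [] T₂
    dist-[]-++ []       T₂ = refl
    dist-[]-++ (y ∷ T₁) T₂ = trans (cong (ι +_) (dist-[]-++ T₁ T₂)) (≡.sym (+-assoc ι _ _))

    dist-++-≤ : ∀ S₁ S₂ T₁ T₂ → dist (S₁ ++ S₂) (T₁ ++ T₂) ≤ dist S₁ T₁ + dist S₂ T₂
    dist-++-≤ []       S₂ []       T₂ = ≤-refl
    dist-++-≤ []       S₂ (y ∷ T₁) T₂ = begin
      dist S₂ (y ∷ T₁ ++ T₂)          ≤⟨ dist-ins S₂ y (T₁ ++ T₂) ⟩
      dist S₂ (T₁ ++ T₂) + ι          ≤⟨ +-monoˡ-≤ ι (dist-++-≤ [] S₂ T₁ T₂) ⟩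
      dist [] T₁ + dist S₂ T₂ + ι     ≡⟨ +-comm _ ι ⟩
      ι + (dist [] T₁ + dist S₂ T₂)   ≡⟨ +-assoc ι _ _ ⟨
      ι + dist [] T₁ + dist S₂ T₂     ∎
      where open ≤-Reasoning
    dist-++-≤ (x ∷ S₁) S₂ []       T₂ = ≤-trans (dist-del x (S₁ ++ S₂) T₂) (dist-++-≤ S₁ S₂ [] T₂)
    dist-++-≤ (x ∷ S₁) S₂ (y ∷ T₁) T₂ =
      ≤-trans (⊓₃-glb (sub (dist-++-≤ S₁ S₂ T₁ T₂))
                      (≤-trans (dist-del x (S₁ ++ S₂) (y ∷ T₁ ++ T₂)) (dist-++-≤ S₁ S₂ (y ∷ T₁) T₂))
                      (ins (dist-++-≤ (x ∷ S₁) S₂ T₁ T₂)))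
              (≤-reflexive (≡.sym (+-distribʳ-⊓₃ (dist S₂ T₂) _ _ _)))
      where
      open ≤-Reasoning
      r = dist S₂ T₂
      sub : dist (S₁ ++ S₂) (T₁ ++ T₂) ≤ dist S₁ T₁ + r →
            dist (x ∷ S₁ ++ S₂) (y ∷ T₁ ++ T₂) ≤ dist S₁ T₁ + mismatch x y + r
      sub ih = begin
        dist (x ∷ S₁ ++ S₂) (y ∷ T₁ ++ T₂)       ≤⟨ dist-sub x (S₁ ++ S₂) y (T₁ ++ T₂) ⟩
        dist (S₁ ++ S₂) (T₁ ++ T₂) + mismatch x y ≤⟨ +-monoˡ-≤ _ ih ⟩
        dist S₁ T₁ + r + mismatch x y            ≡⟨ xy∙z≈xz∙y (dist S₁ T₁) r _ ⟩
        dist S₁ T₁ + mismatch x y + r            ∎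
      ins : dist (x ∷ S₁ ++ S₂) (T₁ ++ T₂) ≤ dist (x ∷ S₁) T₁ + r →
            dist (x ∷ S₁ ++ S₂) (y ∷ T₁ ++ T₂) ≤ dist (x ∷ S₁) T₁ + ι + r
      ins ih = begin
        dist (x ∷ S₁ ++ S₂) (y ∷ T₁ ++ T₂)  ≤⟨ dist-ins (x ∷ S₁ ++ S₂) y (T₁ ++ T₂) ⟩
        dist (x ∷ S₁ ++ S₂) (T₁ ++ T₂) + ι  ≤⟨ +-monoˡ-≤ ι ih ⟩
        dist (x ∷ S₁) T₁ + r + ι            ≡⟨ xy∙z≈xz∙y (dist (x ∷ S₁) T₁) r ι ⟩
        dist (x ∷ S₁) T₁ + ι + r            ∎

    split-sub : ∀ {x y A B L T₁ T₂} → dist A T₁ + dist B T₂ ≤ dist L (T₁ ++ T₂) →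
                dist (x ∷ L) (y ∷ T₁ ++ T₂) ≡ dist L (T₁ ++ T₂) + mismatch x y →
                dist (x ∷ A) (y ∷ T₁) + dist B T₂ ≤ dist (x ∷ L) (y ∷ T₁ ++ T₂)
    split-sub {x} {y} {A} {B} {L} {T₁} {T₂} c e = begin
      dist (x ∷ A) (y ∷ T₁) + dist B T₂          ≤⟨ +-monoˡ-≤ _ (dist-sub x A y T₁) ⟩
      dist A T₁ + mismatch x y + dist B T₂       ≡⟨ xy∙z≈xz∙y (dist A T₁) _ _ ⟩
      dist A T₁ + dist B T₂ + mismatch x y       ≤⟨ +-monoˡ-≤ _ c ⟩
      dist L (T₁ ++ T₂) + mismatch x y           ≡⟨ e ⟨
      dist (x ∷ L) (y ∷ T₁ ++ T₂)                ∎
      where open ≤-Reasoning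

    split-ins : ∀ {y A B L T₁ T₂} → dist A T₁ + dist B T₂ ≤ dist L (T₁ ++ T₂) →
                dist L (y ∷ T₁ ++ T₂) ≡ dist L (T₁ ++ T₂) + ι →
                dist A (y ∷ T₁) + dist B T₂ ≤ dist L (y ∷ T₁ ++ T₂)
    split-ins {y} {A} {B} {L} {T₁} {T₂} c e = begin
      dist A (y ∷ T₁) + dist B T₂                ≤⟨ +-monoˡ-≤ _ (dist-ins A y T₁) ⟩
      dist A T₁ + ι + dist B T₂                  ≡⟨ xy∙z≈xz∙y (dist A T₁) _ _ ⟩
      dist A T₁ + dist B T₂ + ι                  ≤⟨ +-monoˡ-≤ ι c ⟩
      dist L (T₁ ++ T₂) + ι                      ≡⟨ e ⟨
      dist L (y ∷ T₁ ++ T₂)                      ∎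
      where open ≤-Reasoning

    record SourceSplit (S T₁ T₂ : List E) : Set where
      constructor split
      field
        S₁ S₂ : List E
        concat≡ : S₁ ++ S₂ ≡ S
        cost-≤  : dist S₁ T₁ + dist S₂ T₂ ≤ dist S (T₁ ++ T₂)

    source-split : ∀ S T₁ T₂ → SourceSplit S T₁ T₂
    source-split S        []       T₂ = split [] S refl ≤-refl
    source-split []       (y ∷ T₁) T₂ = split [] [] refl (≤-reflexive (≡.sym (dist-[]-++ (y ∷ T₁) T₂)))
    source-split (x ∷ S) (y ∷ T₁) T₂ = by (first-move x S y (T₁ ++ T₂))
      (source-split S T₁ T₂) (source-split S (y ∷ T₁) T₂) (source-split (x ∷ S) T₁ T₂)
      where
      by : FirstMove x S y (T₁ ++ T₂) → SourceSplit S T₁ T₂ → SourceSplit S (y ∷ T₁) T₂ →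
           SourceSplit (x ∷ S) T₁ T₂ → SourceSplit (x ∷ S) (y ∷ T₁) T₂
      by (substitution e) (split S₁ S₂ refl c) _ _ = split (x ∷ S₁) S₂ refl (split-sub {L = S₁ ++ S₂} {T₁} {T₂} c e)
      by (deletion e) _ (split S₁ S₂ refl c) _ = split (x ∷ S₁) S₂ refl
        (≤-trans (+-monoˡ-≤ _ (dist-del x S₁ (y ∷ T₁))) (≤-trans c (≤-reflexive (≡.sym e))))
      by (insertion e) _ _ (split S₁ S₂ eq c) = split S₁ S₂ eq (split-ins {L = x ∷ S} {T₁} {T₂} c e)

    record TargetSplit (S₁ S₂ T : List E) : Set where
      constructor split
      field
        T₁ T₂ : List E
        concat≡ : T₁ ++ T₂ ≡ T
        cost-≤  : dist S₁ T₁ + dist S₂ T₂ ≤ dist (S₁ ++ S₂) T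

    target-split : ∀ S₁ S₂ T → TargetSplit S₁ S₂ T
    target-split []       S₂ T       = split [] T refl ≤-refl
    target-split (x ∷ S₁) S₂ []      = split [] [] refl z≤n
    target-split (x ∷ S₁) S₂ (y ∷ T) = by (first-move x (S₁ ++ S₂) y T)
      (target-split S₁ S₂ T) (target-split S₁ S₂ (y ∷ T)) (target-split (x ∷ S₁) S₂ T)
      where
      by : FirstMove x (S₁ ++ S₂) y T → TargetSplit S₁ S₂ T → TargetSplit S₁ S₂ (y ∷ T) →
           TargetSplit (x ∷ S₁) S₂ T → TargetSplit (x ∷ S₁) S₂ (y ∷ T)
      by (substitution e) (split T₁ T₂ refl c) _ _ = split (y ∷ T₁) T₂ refl (split-sub {L = S₁ ++ S₂} {T₁} {T₂} c e)
      by (deletion e) _ (split T₁ T₂ eq c) _ = split T₁ T₂ eq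
        (≤-trans (+-monoˡ-≤ _ (dist-del x S₁ T₁)) (≤-trans c (≤-reflexive (≡.sym e))))
      by (insertion e) _ _ (split T₁ T₂ refl c) = split (y ∷ T₁) T₂ refl (split-ins {L = x ∷ S₁ ++ S₂} {T₁} {T₂} c e)

    dist-++ˡ-≤ : ∀ W S T → dist (W ++ S) T ≤ dist S T
    dist-++ˡ-≤ W S T = dist-++-≤ W S [] T

    dist-++ʳ-≤ : ∀ S W T → dist (S ++ W) T ≤ dist S T
    dist-++ʳ-≤ S W T = begin
      dist (S ++ W) T          ≡⟨ cong (dist (S ++ W)) (++-identityʳ T) ⟨
      dist (S ++ W) (T ++ [])  ≤⟨ dist-++-≤ S W T [] ⟩
      dist S T + 0             ≡⟨ +-identityʳ _ ⟩
      dist S T                 ∎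
      where open ≤-Reasoning

    dist-++₄-≤ : ∀ S₁ S₂ S₃ S₄ T₁ T₂ T₃ T₄ →
                 dist (S₁ ++ S₂ ++ S₃ ++ S₄) (T₁ ++ T₂ ++ T₃ ++ T₄) ≤
                 dist S₁ T₁ + (dist S₂ T₂ + (dist S₃ T₃ + dist S₄ T₄))
    dist-++₄-≤ S₁ S₂ S₃ S₄ T₁ T₂ T₃ T₄ =
      ≤-trans (dist-++-≤ S₁ _ T₁ _)
        (+-monoʳ-≤ _ (≤-trans (dist-++-≤ S₂ _ T₂ _) (+-monoʳ-≤ _ (dist-++-≤ S₃ S₄ T₃ T₄))))

    dist-≤-prefix : ∀ {S W L} → S ++ W ≡ L → ∀ T → dist L T ≤ dist S T
    dist-≤-prefix {S} {W} refl T = dist-++ʳ-≤ S W T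

    dist-≤-suffix : ∀ {S W L} → W ++ S ≡ L → ∀ T → dist L T ≤ dist S T
    dist-≤-suffix {S} {W} refl T = dist-++ˡ-≤ W S T

    dist-≤-length : ∀ S T → length T ≤ length S → dist S T ≤ length T
    dist-≤-length S       []      _         = z≤n
    dist-≤-length (x ∷ S) (y ∷ T) (s≤s T≤S) = begin
      dist (x ∷ S) (y ∷ T)       ≤⟨ dist-sub x S y T ⟩
      dist S T + mismatch x y    ≤⟨ +-mono-≤ (dist-≤-length S T T≤S) (mismatch≤1 x y) ⟩
      length T + 1               ≡⟨ +-comm (length T) 1 ⟩
      suc (length T)             ∎
      where open ≤-Reasoning

    dist-≤-common-length : ∀ {k} S T → length S ≡ k → length T ≡ k → dist S T ≤ k
    dist-≤-common-length S T refl |T| = subst (dist S T ≤_) |T| (dist-≤-length S T (≤-reflexive |T|))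

    dist-self : ∀ S → dist S S ≡ 0
    dist-self []      = refl
    dist-self (x ∷ S) = n≤0⇒n≡0 (begin
      dist (x ∷ S) (x ∷ S)       ≤⟨ dist-sub x S x S ⟩
      dist S S + mismatch x x    ≡⟨ cong₂ _+_ (dist-self S) (mismatch-self x) ⟩
      0                          ∎)
      where open ≤-Reasoning

    module _ (1≤ι : 1 ≤ ι) where

      count-≤-dist : ∀ {P S} → Avoids P S → ∀ T → count P T ≤ dist S T
      count-≤-dist {P} {S}     avoid    []      = z≤n
      count-≤-dist {P} {[]}    []       (y ∷ T) =
        ≤-trans (count-∷-≤ P y T) (+-mono-≤ 1≤ι (count-≤-dist [] T))
      count-≤-dist {P} {x ∷ S} (px ∷ avoid) (y ∷ T) = ⊓₃-glb sub
        (count-≤-dist avoid (y ∷ T))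
        (≤-trans (count-∷-≤ P y T)
                 (≤-trans (+-mono-≤ 1≤ι (count-≤-dist (px ∷ avoid) T)) (≤-reflexive (+-comm ι _))))
        where
        sub : count P (y ∷ T) ≤ dist S T + mismatch x y
        sub with x ≟ y
        ... | yes refl rewrite px = ≤-trans (count-≤-dist avoid T) (m≤m+n _ _)
        ... | no _ = ≤-trans (count-∷-≤ P y T) (≤-trans (s≤s (count-≤-dist avoid T)) (≤-reflexive (+-comm 1 _)))

      length-≤-dist : ∀ {P S T} → Avoids P S → All (λ y → P y ≡ true) T → length T ≤ dist S T
      length-≤-dist {T = T} avoid all = subst (_≤ dist _ T) (count-all all) (count-≤-dist avoid T)

  module _ {A : Set} where

    ++-prefix-or-suffix : ∀ (L₁ L₂ R₁ R₂ : List A) → L₁ ++ L₂ ≡ R₁ ++ R₂ →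
                          (Σ[ W ∈ List A ] L₁ ++ W ≡ R₁) ⊎ (Σ[ W ∈ List A ] W ++ L₂ ≡ R₂)
    ++-prefix-or-suffix []       L₂ R₁       R₂ _  = inj₁ (R₁ , refl)
    ++-prefix-or-suffix (l ∷ L₁) L₂ []       R₂ eq = inj₂ (l ∷ L₁ , eq)
    ++-prefix-or-suffix (l ∷ L₁) L₂ (r ∷ R₁) R₂ eq with ∷-injective eq
    ... | refl , eq′ with ++-prefix-or-suffix L₁ L₂ R₁ R₂ eq′
    ...   | inj₁ (W , p) = inj₁ (W , cong (l ∷_) p)
    ...   | inj₂ s       = inj₂ s

    concatFrom : (ℕ → List A) → ℕ → ℕ → List A
    concatFrom f i zero    = []
    concatFrom f i (suc d) = f i ++ concatFrom f (suc i) d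

    concatFrom-shift : ∀ f i d → concatFrom f (suc i) d ≡ concatFrom (f ∘ suc) i d
    concatFrom-shift f i zero    = refl
    concatFrom-shift f i (suc d) = cong (f (suc i) ++_) (concatFrom-shift f (suc i) d)

    concatFrom-snoc : ∀ f i d → concatFrom f i (suc d) ≡ concatFrom f i d ++ f (i + d)
    concatFrom-snoc f i zero    = trans (++-identityʳ (f i)) (cong f (≡.sym (+-identityʳ i)))
    concatFrom-snoc f i (suc d) = begin
      f i ++ concatFrom f (suc i) (suc d)        ≡⟨ cong (f i ++_) (concatFrom-snoc f (suc i) d) ⟩
      f i ++ concatFrom f (suc i) d ++ f (suc i + d) ≡⟨ ++-assoc (f i) _ _ ⟨
      concatFrom f i (suc d) ++ f (suc i + d)    ≡⟨ cong (λ j → concatFrom f i (suc d) ++ f j) (+-suc i d) ⟨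
      concatFrom f i (suc d) ++ f (i + suc d)    ∎
      where open ≡-Reasoning

    concatFrom-tabulate : ∀ {n} f (g : Fin n → List A) → (∀ j → f (toℕ j) ≡ g j) →
                          concatFrom f 0 n ≡ concat (tabulate g)
    concatFrom-tabulate {zero}  f g f≗g = refl
    concatFrom-tabulate {suc n} f g f≗g = cong₂ _++_ (f≗g zero)
      (trans (concatFrom-shift f 0 n) (concatFrom-tabulate (f ∘ suc) (g ∘ suc) (f≗g ∘ suc)))

    -- The cut of P₁ ++ P₂ lies inside the piece f (i + a), which both P₁ and P₂ are allowed to keep.
    concatFrom-cut : ∀ f i d P₁ P₂ → P₁ ++ P₂ ≡ concatFrom f i (suc d) →
      Σ[ a ∈ ℕ ] Σ[ b ∈ ℕ ] a + b ≡ d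
        × (Σ[ W ∈ List A ] P₁ ++ W ≡ concatFrom f i (suc a))
        × (Σ[ W ∈ List A ] W ++ P₂ ≡ concatFrom f (i + a) (suc b))
    concatFrom-cut f i zero P₁ P₂ eq =
      0 , 0 , refl , (P₂ , eq) , (P₁ , trans eq (cong (λ j → f j ++ []) (≡.sym (+-identityʳ i))))
    concatFrom-cut f i (suc d) P₁ P₂ eq
      with ++-prefix-or-suffix P₁ P₂ (f i) (concatFrom f (suc i) (suc d)) eq
    ... | inj₁ (W , P₁W≡fi) =
      0 , suc d , refl , (W ++ [] , trans (≡.sym (++-assoc P₁ W [])) (cong (_++ []) P₁W≡fi)) ,
      (P₁ , trans eq (cong (λ j → concatFrom f j (suc (suc d))) (≡.sym (+-identityʳ i))))
    ... | inj₂ (W , WP₂≡rest) with concatFrom-cut f (suc i) d W P₂ WP₂≡rest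
    ...   | a , b , refl , (W₁ , pre) , (W₂ , suf) =
      suc a , b , refl ,
      (W₁ , trans (cong (_++ W₁) P₁≡fiW) (trans (++-assoc (f i) W W₁) (cong (f i ++_) pre))) ,
      (W₂ , trans suf (cong (λ j → concatFrom f j (suc b)) (≡.sym (+-suc i a))))
      where
      P₁≡fiW : P₁ ≡ f i ++ W
      P₁≡fiW = ++-cancelʳ P₂ P₁ (f i ++ W)
        (trans eq (trans (cong (f i ++_) (≡.sym WP₂≡rest)) (≡.sym (++-assoc (f i) W P₂))))

    concat-tabulate-rotate : ∀ {n} (g : Fin n → List A) v →
                             concat (tabulate (λ j → v ++ g j)) ++ v ≡ v ++ concat (tabulate (λ j → g j ++ v))
    concat-tabulate-rotate {zero}  g v = ≡.sym (++-identityʳ v)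
    concat-tabulate-rotate {suc n} g v = begin
      ((v ++ g zero) ++ R) ++ v                ≡⟨ ++-assoc (v ++ g zero) R v ⟩
      (v ++ g zero) ++ R ++ v                  ≡⟨ cong ((v ++ g zero) ++_) (concat-tabulate-rotate (g ∘ suc) v) ⟩
      (v ++ g zero) ++ v ++ R′                 ≡⟨ ++-assoc v (g zero) (v ++ R′) ⟩
      v ++ g zero ++ v ++ R′                   ≡⟨ cong (v ++_) (++-assoc (g zero) v R′) ⟨
      v ++ (g zero ++ v) ++ R′                 ∎
      where
      open ≡-Reasoning
      R  = concat (tabulate (λ j → v ++ g (suc j)))
      R′ = concat (tabulate (λ j → g (suc j) ++ v))

    concatFrom-avoids : ∀ {P} f → (∀ k → Avoids P (f k)) → ∀ i d → Avoids P (concatFrom f i d)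
    concatFrom-avoids f avoid i zero    = []
    concatFrom-avoids f avoid i (suc d) = Allₚ.++⁺ (avoid i) (concatFrom-avoids f avoid (suc i) d)

  module Reduction {Σ : Set} (_≟_ : DecidableEquality Σ) (ι : ℕ) (1≤ι : 1 ≤ ι) (ℓX ℓY : ℕ) where

    open Distance (_≟E_ _≟_) ι public
    open import Algebra.Solver.Monoid (++-monoid (Ext Σ)) using (solve; _⊕_; _⊜_)

    ℓ : ℕ
    ℓ = ℓX + ℓY

    runA runB runC runD gadget CAB : List (Ext Σ)
    runA   = replicate ℓY chA
    runB   = replicate ℓ chB
    runC   = replicate ℓ chC
    runD   = replicate ℓX chD
    gadget = runB ++ runD ++ runC
    CAB    = runC ++ runA ++ runB

    unit : List Σ → List (Ext Σ)
    unit X = map sym X ++ CAB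

    chunk : List Σ → List (Ext Σ)
    chunk Y = runB ++ runD ++ runC ++ map sym Y

    chunk≡gadget++ : ∀ Y → chunk Y ≡ gadget ++ map sym Y
    chunk≡gadget++ Y = solve 4 (λ b d c y → b ⊕ d ⊕ c ⊕ y ⊜ (b ⊕ d ⊕ c) ⊕ y) refl runB runD runC (map sym Y)

    dollars : ℕ → List (Ext Σ)
    dollars k = replicate k dollar

    dist⁺ : List Σ → List Σ → ℕ
    dist⁺ X Y = dist (dollars (length Y) ++ map sym X ++ dollars (length Y)) (map sym Y)

    isB isC isD isSym isDC isBCD : Ext Σ → Bool
    isB chB = true
    isB _   = false
    isC chC = true
    isC _   = false
    isD chD = true
    isD _   = false
    isSym (sym _) = true
    isSym _       = false
    isDC c  = isD c ∨ isC c
    isBCD c = isB c ∨ isDC c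

    syms-avoid : ∀ {P : Ext Σ → Bool} → (∀ s → P (sym s) ≡ false) → ∀ X → Avoids P (map sym X)
    syms-avoid never X = Allₚ.map⁺ (All.universal never X)

    all-sym : ∀ Y → All (λ c → isSym c ≡ true) (map sym Y)
    all-sym Y = Allₚ.map⁺ (All.universal (λ _ → refl) Y)

    replicate-avoids : ∀ {P : Ext Σ → Bool} k c → P c ≡ false → Avoids P (replicate k c)
    replicate-avoids k c = Allₚ.replicate⁺ k

    CAB-avoids : ∀ {P : Ext Σ → Bool} → P chC ≡ false → P chA ≡ false → P chB ≡ false → Avoids P CAB
    CAB-avoids c a b =
      Allₚ.++⁺ (replicate-avoids ℓ chC c) (Allₚ.++⁺ (replicate-avoids ℓY chA a) (replicate-avoids ℓ chB b))

    CAB-avoids-sym : Avoids isSym CAB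
    CAB-avoids-sym = CAB-avoids refl refl refl

    CAB-avoids-D : Avoids isD CAB
    CAB-avoids-D = CAB-avoids refl refl refl

    unit-avoids-D : ∀ X → Avoids isD (unit X)
    unit-avoids-D X = Allₚ.++⁺ (syms-avoid (λ _ → refl) X) CAB-avoids-D

    -- Both sides of the padding pay exactly one substitution per character of Y they absorb.
    dist-padding : ∀ {P Q P′ Q′} X Y → Avoids isSym P → Avoids isSym Q →
                   length Y ≤ length P′ → length Y ≤ length Q′ →
                   dist (P′ ++ map sym X ++ Q′) (map sym Y) ≤ dist (P ++ map sym X ++ Q) (map sym Y)
    dist-padding {P} {Q} {P′} {Q′} X Y noP noQ Y≤P′ Y≤Q′ with target-split P (map sym X ++ Q) (map sym Y)
    ... | split Y₁ Y₂₃ Y≡ c₁ with target-split (map sym X) Q Y₂₃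
    ...   | split Y₂ Y₃ refl c₂ = begin
      dist (P′ ++ map sym X ++ Q′) (map sym Y)                    ≡⟨ cong (dist _) Y≡ ⟨
      dist (P′ ++ map sym X ++ Q′) (Y₁ ++ Y₂ ++ Y₃)               ≤⟨ dist-++-≤ P′ _ Y₁ _ ⟩
      dist P′ Y₁ + dist (map sym X ++ Q′) (Y₂ ++ Y₃)
                                  ≤⟨ +-monoʳ-≤ _ (dist-++-≤ (map sym X) Q′ Y₂ Y₃) ⟩
      dist P′ Y₁ + (dist (map sym X) Y₂ + dist Q′ Y₃)
                                  ≤⟨ +-mono-≤ (dist-≤-length P′ Y₁ (≤-trans Y₁≤Y Y≤P′))
                                              (+-monoʳ-≤ _ (dist-≤-length Q′ Y₃ (≤-trans Y₃≤Y Y≤Q′))) ⟩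
      length Y₁ + (dist (map sym X) Y₂ + length Y₃)
                                  ≤⟨ +-mono-≤ (length-≤-dist 1≤ι noP sym₁) (+-monoʳ-≤ _ (length-≤-dist 1≤ι noQ sym₃)) ⟩
      dist P Y₁ + (dist (map sym X) Y₂ + dist Q Y₃)               ≤⟨ +-monoʳ-≤ _ c₂ ⟩
      dist P Y₁ + dist (map sym X ++ Q) (Y₂ ++ Y₃)                ≤⟨ c₁ ⟩
      dist (P ++ map sym X ++ Q) (map sym Y)                      ∎
      where
      open ≤-Reasoning
      allSym : All (λ c → isSym c ≡ true) (Y₁ ++ Y₂ ++ Y₃)
      allSym = subst (All _) (≡.sym Y≡) (all-sym Y)
      sym₁ = Allₚ.++⁻ˡ Y₁ allSym
      sym₃ = Allₚ.++⁻ʳ Y₂ (Allₚ.++⁻ʳ Y₁ allSym)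
      length≡ : length Y₁ + (length Y₂ + length Y₃) ≡ length Y
      length≡ = begin-equality
        length Y₁ + (length Y₂ + length Y₃) ≡⟨ cong (length Y₁ +_) (length-++ Y₂) ⟨
        length Y₁ + length (Y₂ ++ Y₃)       ≡⟨ length-++ Y₁ ⟨
        length (Y₁ ++ Y₂ ++ Y₃)             ≡⟨ cong length Y≡ ⟩
        length (map sym Y)                  ≡⟨ length-map sym Y ⟩
        length Y                            ∎
      Y₁≤Y : length Y₁ ≤ length Y
      Y₁≤Y = ≤-trans (m≤m+n _ _) (≤-reflexive length≡)
      Y₃≤Y : length Y₃ ≤ length Y
      Y₃≤Y = ≤-trans (≤-trans (m≤n+m _ (length Y₂)) (m≤n+m _ (length Y₁))) (≤-reflexive length≡)

    dist⁺-≤-padded : ∀ {P Q} X Y → Avoids isSym P → Avoids isSym Q →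
                     dist⁺ X Y ≤ dist (P ++ map sym X ++ Q) (map sym Y)
    dist⁺-≤-padded X Y noP noQ =
      dist-padding {P′ = dollars (length Y)} {Q′ = dollars (length Y)} X Y noP noQ |$s| |$s|
      where
      |$s| : length Y ≤ length (dollars (length Y))
      |$s| = ≤-reflexive (≡.sym (length-replicate (length Y)))

    length≤dist-syms : ∀ {S} Y → Avoids isSym S → length Y ≤ dist S (map sym Y)
    length≤dist-syms {S} Y avoid =
      subst (_≤ dist S (map sym Y)) (length-map sym Y) (length-≤-dist 1≤ι avoid (all-sym Y))

    dist⁺-≤-length : ∀ X Y → dist⁺ X Y ≤ length Y
    dist⁺-≤-length X Y = ≤-trans (dist-++ʳ-≤ (dollars (length Y)) _ (map sym Y))
      (dist-≤-common-length (dollars (length Y)) (map sym Y) (length-replicate (length Y)) (length-map sym Y))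

    blockX : List Σ → List (Ext Σ)
    blockX X = runB ++ map sym X ++ runC ++ runA

    X≤runD : ∀ X → length X ≡ ℓX → dist (map sym X) runD ≤ ℓX
    X≤runD X |X| = dist-≤-common-length (map sym X) runD (trans (length-map sym X) |X|) (length-replicate ℓX)

    runA≤Y : ∀ Y → length Y ≡ ℓY → dist runA (map sym Y) ≤ ℓY
    runA≤Y Y |Y| = dist-≤-common-length runA (map sym Y) (length-replicate ℓY) (trans (length-map sym Y) |Y|)

    dist-blockX-chunk : ∀ X Y → length X ≡ ℓX → length Y ≡ ℓY → dist (blockX X) (chunk Y) ≤ ℓ
    dist-blockX-chunk X Y |X| |Y| = begin
      dist (blockX X) (chunk Y)
        ≤⟨ dist-++₄-≤ runB (map sym X) runC runA runB runD runC (map sym Y) ⟩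
      dist runB runB + (dist (map sym X) runD + (dist runC runC + dist runA (map sym Y)))
        ≡⟨ cong₂ (λ p q → p + (dist (map sym X) runD + (q + dist runA (map sym Y)))) (dist-self runB) (dist-self runC) ⟩
      dist (map sym X) runD + dist runA (map sym Y)
        ≤⟨ +-mono-≤ (X≤runD X |X|) (runA≤Y Y |Y|) ⟩
      ℓX + ℓY ∎
      where open ≤-Reasoning

    dist-head-pair : ∀ X Y → length X ≡ ℓX → length Y ≡ ℓY →
                     dist (runA ++ runB ++ map sym X ++ runC) (map sym Y ++ runB ++ runD ++ runC) ≤ ℓ
    dist-head-pair X Y |X| |Y| = begin
      dist (runA ++ runB ++ map sym X ++ runC) (map sym Y ++ runB ++ runD ++ runC)
        ≤⟨ dist-++₄-≤ runA runB (map sym X) runC (map sym Y) runB runD runC ⟩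
      dist runA (map sym Y) + (dist runB runB + (dist (map sym X) runD + dist runC runC))
        ≡⟨ cong₂ (λ p q → dist runA (map sym Y) + (p + (dist (map sym X) runD + q))) (dist-self runB) (dist-self runC) ⟩
      dist runA (map sym Y) + (dist (map sym X) runD + 0)
        ≤⟨ +-mono-≤ (runA≤Y Y |Y|) (+-monoˡ-≤ 0 (X≤runD X |X|)) ⟩
      ℓY + (ℓX + 0)
        ≡⟨ trans (cong (ℓY +_) (+-identityʳ ℓX)) (+-comm ℓY ℓX) ⟩
      ℓ ∎
      where open ≤-Reasoning

    blocks-≤ : ∀ p (Xs : Fin p → Vec Σ ℓX) (Ys : Fin p → Vec Σ ℓY) →
               dist (concat (tabulate (blockX ∘ toList ∘ Xs))) (concat (tabulate (chunk ∘ toList ∘ Ys))) ≤ p * ℓ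
    blocks-≤ zero    Xs Ys = z≤n
    blocks-≤ (suc p) Xs Ys = ≤-trans (dist-++-≤ (blockX X₀) _ (chunk Y₀) _)
      (+-mono-≤ (dist-blockX-chunk X₀ Y₀ (length-toList (Xs zero)) (length-toList (Ys zero)))
                (blocks-≤ p (Xs ∘ suc) (Ys ∘ suc)))
      where
      X₀ = toList (Xs zero)
      Y₀ = toList (Ys zero)

    module _ (m : ℕ) (Xs : Fin (suc m) → Vec Σ ℓX) (Ys : Fin (suc m) → Vec Σ ℓY) where
      bigX bigY : List (Ext Σ)
      bigX = Construction.bigX m ℓX ℓY Xs Ys
      bigY = Construction.bigY m ℓX ℓY Xs Ys

    upper-bound : ∀ m Xs Ys i →
                  dist (bigX m Xs Ys) (bigY m Xs Ys) ≤ m * ℓ + dist⁺ (toList (Xs i)) (toList (Ys i))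
    upper-bound m Xs Ys zero = begin
      dist (bigX m Xs Ys) (bigY m Xs Ys)                             ≡⟨ cong (λ S → dist S (bigY m Xs Ys)) regroup ⟩
      dist (((runA ++ runB) ++ map sym X₀ ++ runC ++ runA) ++ RX) (map sym Y₀ ++ RY)
                                                                     ≤⟨ dist-++-≤ _ RX (map sym Y₀) RY ⟩
      dist ((runA ++ runB) ++ map sym X₀ ++ runC ++ runA) (map sym Y₀) + dist RX RY
                                                                     ≤⟨ +-mono-≤ padding (blocks-≤ m (Xs ∘ suc) (Ys ∘ suc)) ⟩
      dist⁺ X₀ Y₀ + m * ℓ                                            ≡⟨ +-comm _ (m * ℓ) ⟩
      m * ℓ + dist⁺ X₀ Y₀                                            ∎
      where
      open ≤-Reasoning
      X₀ = toList (Xs zero)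
      Y₀ = toList (Ys zero)
      RX = concat (tabulate (blockX ∘ toList ∘ Xs ∘ suc))
      RY = concat (tabulate (chunk ∘ toList ∘ Ys ∘ suc))
      regroup : bigX m Xs Ys ≡ ((runA ++ runB) ++ map sym X₀ ++ runC ++ runA) ++ RX
      regroup = solve 5 (λ a b x c r → a ⊕ (b ⊕ x ⊕ c ⊕ a) ⊕ r ⊜ ((a ⊕ b) ⊕ x ⊕ c ⊕ a) ⊕ r) refl
                  runA runB (map sym X₀) runC RX
      $s-avoid : Avoids isSym (dollars (length Y₀))
      $s-avoid = replicate-avoids (length Y₀) dollar refl
      |Y₀| = length-toList (Ys zero)
      |AB| : length (runA ++ runB) ≡ ℓY + ℓ
      |AB| = trans (length-++ runA) (cong₂ _+_ (length-replicate ℓY) (length-replicate ℓ))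
      |CA| : length (runC ++ runA) ≡ ℓ + ℓY
      |CA| = trans (length-++ runC) (cong₂ _+_ (length-replicate ℓ) (length-replicate ℓY))
      padding : dist ((runA ++ runB) ++ map sym X₀ ++ runC ++ runA) (map sym Y₀) ≤ dist⁺ X₀ Y₀
      padding = dist-padding {P′ = runA ++ runB} {Q′ = runC ++ runA} X₀ Y₀ $s-avoid $s-avoid
        (subst₂ _≤_ (≡.sym |Y₀|) (≡.sym |AB|) (m≤m+n ℓY ℓ))
        (subst₂ _≤_ (≡.sym |Y₀|) (≡.sym |CA|) (m≤n+m ℓY ℓ))
    upper-bound zero    Xs Ys (suc ())
    upper-bound (suc m) Xs Ys (suc i) = begin
      dist (bigX (suc m) Xs Ys) (bigY (suc m) Xs Ys)                 ≡⟨ cong₂ dist regroupX regroupY ⟩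
      dist (headX ++ bigX m (Xs ∘ suc) (Ys ∘ suc)) (headY ++ bigY m (Xs ∘ suc) (Ys ∘ suc))
                                                                     ≤⟨ dist-++-≤ headX _ headY _ ⟩
      dist headX headY + dist (bigX m (Xs ∘ suc) (Ys ∘ suc)) (bigY m (Xs ∘ suc) (Ys ∘ suc))
                                                                     ≤⟨ +-mono-≤ (dist-head-pair X₀ Y₀ |X₀| |Y₀|)
                                                                                 (upper-bound m (Xs ∘ suc) (Ys ∘ suc) i) ⟩
      ℓ + (m * ℓ + dist⁺ (toList (Xs (suc i))) (toList (Ys (suc i)))) ≡⟨ +-assoc ℓ (m * ℓ) _ ⟨
      suc m * ℓ + dist⁺ (toList (Xs (suc i))) (toList (Ys (suc i)))   ∎
      where
      open ≤-Reasoning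
      X₀ = toList (Xs zero)
      Y₀ = toList (Ys zero)
      |X₀| = length-toList (Xs zero)
      |Y₀| = length-toList (Ys zero)
      headX = runA ++ runB ++ map sym X₀ ++ runC
      headY = map sym Y₀ ++ runB ++ runD ++ runC
      RX = concat (tabulate (blockX ∘ toList ∘ Xs ∘ suc))
      RY = concat (tabulate (λ k → chunk (toList (Ys (suc (suc k))))))
      regroupX : bigX (suc m) Xs Ys ≡ headX ++ bigX m (Xs ∘ suc) (Ys ∘ suc)
      regroupX = solve 5 (λ a b x c r → a ⊕ (b ⊕ x ⊕ c ⊕ a) ⊕ r ⊜ (a ⊕ b ⊕ x ⊕ c) ⊕ a ⊕ r) refl
                   runA runB (map sym X₀) runC RX
      regroupY : bigY (suc m) Xs Ys ≡ headY ++ bigY m (Xs ∘ suc) (Ys ∘ suc)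
      regroupY = solve 6 (λ y b d c y₁ r → y ⊕ (b ⊕ d ⊕ c ⊕ y₁) ⊕ r ⊜ (y ⊕ b ⊕ d ⊕ c) ⊕ y₁ ⊕ r) refl
                   (map sym Y₀) runB runD runC (map sym (toList (Ys (suc zero)))) RY

    replicate-≤-dist : ∀ {P : Ext Σ → Bool} {S} k c → Avoids P S → P c ≡ true → k ≤ dist S (replicate k c)
    replicate-≤-dist {S = S} k c avoid pc =
      subst (_≤ dist S (replicate k c)) (count-replicate k pc) (count-≤-dist 1≤ι avoid (replicate k c))

    ℓX≤dist-D : ∀ {S} → Avoids isD S → ∀ T₁ T₂ → ℓX ≤ dist S (T₁ ++ runD ++ T₂)
    ℓX≤dist-D {S} avoid T₁ T₂ = begin
      ℓX                             ≡⟨ count-replicate ℓX refl ⟨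
      count isD runD                 ≤⟨ count-++ˡ-≤ isD runD T₂ ⟩
      count isD (runD ++ T₂)         ≤⟨ count-++ʳ-≤ isD T₁ (runD ++ T₂) ⟩
      count isD (T₁ ++ runD ++ T₂)   ≤⟨ count-≤-dist 1≤ι avoid (T₁ ++ runD ++ T₂) ⟩
      dist S (T₁ ++ runD ++ T₂)      ∎
      where open ≤-Reasoning

    -- Without a B before a C, the gadget must pay for its whole B-run or its whole C-run.
    ℓX+ℓ≤dist-gadget : ∀ {S W U V} → S ++ W ≡ U ++ V → Avoids isB U → Avoids isC V → Avoids isD S →
                       ℓX + ℓ ≤ dist S gadget
    ℓX+ℓ≤dist-gadget {S} {W} {U} {V} eq noB noC noD with source-split S runB (runD ++ runC)
    ... | split S₁ S₂ refl c with ++-prefix-or-suffix S₁ (S₂ ++ W) U V (trans (≡.sym (++-assoc S₁ S₂ W)) eq)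
    ...   | inj₁ (W′ , S₁W′≡U) = begin
      ℓX + ℓ                                   ≡⟨ +-comm ℓX ℓ ⟩
      ℓ + ℓX                                   ≤⟨ +-mono-≤ (replicate-≤-dist ℓ chB (prefix-avoids S₁W′≡U noB) refl)
                                                           (ℓX≤dist-D (suffix-avoids refl noD) [] runC) ⟩
      dist S₁ runB + dist S₂ (runD ++ runC)    ≤⟨ c ⟩
      dist (S₁ ++ S₂) gadget                   ∎
      where open ≤-Reasoning
    ...   | inj₂ (W′ , W′S₂W≡V) = begin
      ℓX + ℓ                                   ≡⟨ cong₂ _+_ (count-replicate ℓX refl) (count-replicate ℓ refl) ⟨
      count isDC runD + count isDC runC        ≡⟨ count-++ isDC runD runC ⟨
      count isDC (runD ++ runC)                ≤⟨ count-≤-dist 1≤ι noDC (runD ++ runC) ⟩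
      dist S₂ (runD ++ runC)                   ≤⟨ m≤n+m _ _ ⟩
      dist S₁ runB + dist S₂ (runD ++ runC)    ≤⟨ c ⟩
      dist (S₁ ++ S₂) gadget                   ∎
      where
      open ≤-Reasoning
      noDC : Avoids isDC S₂
      noDC = avoids-∨ (suffix-avoids {W = S₁} refl noD)
                      (prefix-avoids {W = W} refl (suffix-avoids {W = W′} W′S₂W≡V noC))

    XCA-avoids-B : ∀ X → Avoids isB (map sym X ++ runC ++ runA)
    XCA-avoids-B X =
      Allₚ.++⁺ (syms-avoid (λ _ → refl) X) (Allₚ.++⁺ (replicate-avoids ℓ chC refl) (replicate-avoids ℓY chA refl))

    BX-avoids-C : ∀ X → Avoids isC (runB ++ map sym X)
    BX-avoids-C X = Allₚ.++⁺ (replicate-avoids ℓ chB refl) (syms-avoid (λ _ → refl) X)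

    ℓ+ℓY≤dist-unit : ∀ X Y → length Y ≡ ℓY → ℓ + ℓY ≤ dist (unit X) (chunk Y)
    ℓ+ℓY≤dist-unit X Y |Y| rewrite chunk≡gadget++ Y with source-split (unit X) gadget (map sym Y)
    ... | split S₁ S₂ S₁S₂≡ c with ++-prefix-or-suffix S₁ S₂ (map sym X) CAB S₁S₂≡
    ...   | inj₁ (W , S₁W≡X) = begin
      ℓ + ℓY                                  ≤⟨ +-monoʳ-≤ ℓ (≤-trans (m≤n+m ℓY ℓX) (m≤n+m ℓ ℓX)) ⟩
      ℓ + (ℓX + ℓ)                            ≡⟨ cong₂ _+_ (count-replicate ℓ refl)
                                                   (cong₂ _+_ (count-replicate ℓX refl) (count-replicate ℓ refl)) ⟨
      count isBCD runB + (count isBCD runD + count isBCD runC)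
                                              ≡⟨ cong (count isBCD runB +_) (count-++ isBCD runD runC) ⟨
      count isBCD runB + count isBCD (runD ++ runC) ≡⟨ count-++ isBCD runB _ ⟨
      count isBCD gadget                      ≤⟨ count-≤-dist 1≤ι noBCD gadget ⟩
      dist S₁ gadget                          ≤⟨ m≤m+n _ _ ⟩
      dist S₁ gadget + dist S₂ (map sym Y)    ≤⟨ c ⟩
      dist (unit X) (gadget ++ map sym Y)     ∎
      where
      open ≤-Reasoning
      noBCD : Avoids isBCD S₁
      noBCD = prefix-avoids S₁W≡X (syms-avoid (λ _ → refl) X)
    ...   | inj₂ (W , WS₂≡CAB) = begin
      ℓ + ℓY                                  ≤⟨ +-monoˡ-≤ ℓY (m≤n+m ℓ ℓX) ⟩
      ℓX + ℓ + ℓY                             ≤⟨ +-mono-≤ gadget-cost (≤-trans (≤-reflexive (≡.sym |Y|))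
                                                   (length≤dist-syms Y (suffix-avoids WS₂≡CAB CAB-avoids-sym))) ⟩
      dist S₁ gadget + dist S₂ (map sym Y)    ≤⟨ c ⟩
      dist (unit X) (gadget ++ map sym Y)     ∎
      where
      open ≤-Reasoning
      regroup : S₁ ++ S₂ ≡ (map sym X ++ runC ++ runA) ++ runB
      regroup = trans S₁S₂≡
        (solve 4 (λ x c a b → x ⊕ c ⊕ a ⊕ b ⊜ (x ⊕ c ⊕ a) ⊕ b) refl (map sym X) runC runA runB)
      gadget-cost : ℓX + ℓ ≤ dist S₁ gadget
      gadget-cost = ℓX+ℓ≤dist-gadget regroup (XCA-avoids-B X) (replicate-avoids ℓ chB refl)
                      (prefix-avoids S₁S₂≡ (unit-avoids-D X))

    straddle-avoids-D : ∀ X X′ → Avoids isD (map sym X ++ CAB ++ map sym X′)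
    straddle-avoids-D X X′ = Allₚ.++⁺ (syms-avoid (λ _ → refl) X) (Allₚ.++⁺ CAB-avoids-D (syms-avoid (λ _ → refl) X′))

    -- Either the gadget is matched inside the straddle region, or the suffix matched against T lies in R.
    ℓX+ℓ⊓q≤dist-straddle : ∀ X X′ R T {q} → Avoids isD R → (∀ {S W} → W ++ S ≡ R → q ≤ dist S T) →
                           ℓX + ℓ ⊓ q ≤ dist ((map sym X ++ CAB ++ map sym X′) ++ R) (gadget ++ T)
    ℓX+ℓ⊓q≤dist-straddle X X′ R T {q} noD-R q≤ with source-split (F ++ R) gadget T
      where F = map sym X ++ CAB ++ map sym X′
    ... | split S₁ S₂ S₁S₂≡ c with ++-prefix-or-suffix S₁ S₂ (map sym X ++ CAB ++ map sym X′) R S₁S₂≡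
    ...   | inj₁ (W , S₁W≡) = begin
      ℓX + ℓ ⊓ q                    ≤⟨ +-monoʳ-≤ ℓX (m⊓n≤m ℓ q) ⟩
      ℓX + ℓ                        ≤⟨ ℓX+ℓ≤dist-gadget (trans S₁W≡ regroup) (XCA-avoids-B X) (BX-avoids-C X′) noD ⟩
      dist S₁ gadget                ≤⟨ m≤m+n _ _ ⟩
      dist S₁ gadget + dist S₂ T    ≤⟨ c ⟩
      dist _ (gadget ++ T)          ∎
      where
      open ≤-Reasoning
      regroup : map sym X ++ CAB ++ map sym X′ ≡ (map sym X ++ runC ++ runA) ++ runB ++ map sym X′
      regroup = solve 5 (λ x c a b x′ → x ⊕ (c ⊕ a ⊕ b) ⊕ x′ ⊜ (x ⊕ c ⊕ a) ⊕ b ⊕ x′) refl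
                  (map sym X) runC runA runB (map sym X′)
      noD = prefix-avoids S₁S₂≡ (Allₚ.++⁺ (straddle-avoids-D X X′) noD-R)
    ...   | inj₂ (W , WS₂≡R) = ≤-trans (+-mono-≤ (ℓX≤dist-D noD runB runC) (≤-trans (m⊓n≤n ℓ q) (q≤ WS₂≡R))) c
      where
      noD = prefix-avoids S₁S₂≡ (Allₚ.++⁺ (straddle-avoids-D X X′) noD-R)

    ℓX+ℓY≤dist-two-units : ∀ X X′ Y → length Y ≡ ℓY → ℓX + ℓY ≤ dist (unit X ++ unit X′) (chunk Y)
    ℓX+ℓY≤dist-two-units X X′ Y |Y| = begin
      ℓX + ℓY
        ≡⟨ cong (ℓX +_) (m≥n⇒m⊓n≡n (m≤n+m ℓY ℓX)) ⟨
      ℓX + ℓ ⊓ ℓY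
        ≤⟨ ℓX+ℓ⊓q≤dist-straddle X X′ CAB (map sym Y) CAB-avoids-D ℓY≤ ⟩
      dist ((map sym X ++ CAB ++ map sym X′) ++ CAB) (gadget ++ map sym Y)
        ≡⟨ cong₂ dist regroup (chunk≡gadget++ Y) ⟨
      dist (unit X ++ unit X′) (chunk Y) ∎
      where
      open ≤-Reasoning
      regroup : unit X ++ unit X′ ≡ (map sym X ++ CAB ++ map sym X′) ++ CAB
      regroup = solve 3 (λ x k x′ → (x ⊕ k) ⊕ (x′ ⊕ k) ⊜ (x ⊕ k ⊕ x′) ⊕ k) refl (map sym X) CAB (map sym X′)
      ℓY≤ : ∀ {S W} → W ++ S ≡ CAB → ℓY ≤ dist S (map sym Y)
      ℓY≤ WS≡CAB = subst (_≤ _) |Y| (length≤dist-syms Y (suffix-avoids WS≡CAB CAB-avoids-sym))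

    ℓX+M≤dist-three-units : ∀ {M} X X′ X″ Y → M ≤ ℓY → M ≤ dist⁺ X″ Y →
                            ℓX + M ≤ dist (unit X ++ unit X′ ++ unit X″) (chunk Y)
    ℓX+M≤dist-three-units {M} X X′ X″ Y M≤ℓY M≤dist⁺ = begin
      ℓX + M
        ≡⟨ cong (ℓX +_) (m≥n⇒m⊓n≡n (≤-trans M≤ℓY (m≤n+m ℓY ℓX))) ⟨
      ℓX + ℓ ⊓ M
        ≤⟨ ℓX+ℓ⊓q≤dist-straddle X X′ R (map sym Y) noD-R M≤ ⟩
      dist ((map sym X ++ CAB ++ map sym X′) ++ R) (gadget ++ map sym Y)
        ≡⟨ cong₂ dist regroup (chunk≡gadget++ Y) ⟨
      dist (unit X ++ unit X′ ++ unit X″) (chunk Y) ∎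
      where
      open ≤-Reasoning
      R = CAB ++ map sym X″ ++ CAB
      regroup : unit X ++ unit X′ ++ unit X″ ≡ (map sym X ++ CAB ++ map sym X′) ++ R
      regroup = solve 4 (λ x k x′ x″ → (x ⊕ k) ⊕ (x′ ⊕ k) ⊕ (x″ ⊕ k) ⊜ (x ⊕ k ⊕ x′) ⊕ k ⊕ x″ ⊕ k) refl
                  (map sym X) CAB (map sym X′) (map sym X″)
      noD-R : Avoids isD R
      noD-R = Allₚ.++⁺ CAB-avoids-D (unit-avoids-D X″)
      M≤ : ∀ {S W} → W ++ S ≡ R → M ≤ dist S (map sym Y)
      M≤ {S} {W} WS≡R = begin
        M                                  ≤⟨ M≤dist⁺ ⟩
        dist⁺ X″ Y                         ≤⟨ dist⁺-≤-padded X″ Y CAB-avoids-sym CAB-avoids-sym ⟩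
        dist R (map sym Y)                 ≤⟨ dist-≤-suffix WS≡R (map sym Y) ⟩
        dist S (map sym Y)                 ∎

    module LowerBound (x y : ℕ → List Σ) (M : ℕ) (M≤ℓY : M ≤ ℓY)
                      (|y| : ∀ k → length (y k) ≡ ℓY) (M≤dist⁺ : ∀ k → M ≤ dist⁺ (x k) (y k)) where

      block : ℕ → List Σ
      block zero    = []
      block (suc k) = x k

      units : ℕ → ℕ → List (Ext Σ)
      units i d = concatFrom (unit ∘ block) i (suc d)

      prefixY : ℕ → List (Ext Σ)
      prefixY zero    = map sym (y 0)
      prefixY (suc k) = prefixY k ++ chunk (y (suc k))

      prefix-split : ∀ k u → Σ[ a ∈ ℕ ] Σ[ b ∈ ℕ ] a + b ≡ u ×
        dist (units 0 a) (prefixY k) + dist (units a b) (chunk (y (suc k))) ≤ dist (units 0 u) (prefixY (suc k))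
      prefix-split k u with source-split (units 0 u) (prefixY k) (chunk (y (suc k)))
      ... | split P₁ P₂ P₁P₂≡ c with concatFrom-cut (unit ∘ block) 0 u P₁ P₂ P₁P₂≡
      ...   | a , b , a+b≡u , (W₁ , P₁W₁≡) , (W₂ , W₂P₂≡) = a , b , a+b≡u ,
        ≤-trans (+-mono-≤ (dist-≤-prefix {W = W₁} P₁W₁≡ (prefixY k))
                          (dist-≤-suffix {W = W₂} W₂P₂≡ (chunk (y (suc k))))) c

      units-avoid-D : ∀ i b → Avoids isD (units i b)
      units-avoid-D i b = concatFrom-avoids (unit ∘ block) (unit-avoids-D ∘ block) i (suc b)

      window : ∀ i b k → ℓ + ℓY ≤ dist (units i b) (chunk (y k)) + b * ℓY
      window i zero k rewrite ++-identityʳ (unit (block i)) =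
        ≤-trans (ℓ+ℓY≤dist-unit (block i) (y k) (|y| k)) (m≤m+n _ _)
      window i (suc zero) k rewrite ++-identityʳ (unit (block (suc i))) =
        +-mono-≤ (ℓX+ℓY≤dist-two-units (block i) (block (suc i)) (y k) (|y| k))
                 (≤-reflexive (≡.sym (+-identityʳ ℓY)))
      window i (suc (suc b)) k = begin
        ℓX + ℓY + ℓY     ≡⟨ +-assoc ℓX ℓY ℓY ⟩
        ℓX + (ℓY + ℓY)   ≤⟨ +-mono-≤ (ℓX≤dist-D (units-avoid-D i (2 + b)) runB _) (+-monoʳ-≤ ℓY (m≤m+n ℓY _)) ⟩
        dist (units i (2 + b)) (chunk (y k)) + (2 + b) * ℓY ∎
        where open ≤-Reasoning

      window-aligned : ∀ i → ℓ + ℓY + M ≤ dist (units i 2) (chunk (y (suc i))) + 2 * ℓY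
      window-aligned i rewrite ++-identityʳ (unit (x (suc i))) = begin
        ℓX + ℓY + ℓY + M          ≡⟨ regroup ℓX ℓY M ⟩
        ℓX + M + (ℓY + (ℓY + 0))  ≤⟨ +-monoˡ-≤ _ (ℓX+M≤dist-three-units (block i) (x i) (x (suc i)) (y (suc i))
                                                                      M≤ℓY (M≤dist⁺ (suc i))) ⟩
        dist (unit (block i) ++ unit (x i) ++ unit (x (suc i))) (chunk (y (suc i))) + 2 * ℓY ∎
        where
        open ≤-Reasoning
        regroup : ∀ p q r → p + q + q + r ≡ p + r + (q + (q + 0))
        regroup = solve-∀

      window-wide : ∀ i b k → ℓ + ℓY + M ≤ dist (units i (3 + b)) (chunk (y k)) + (3 + b) * ℓY
      window-wide i b k = begin
        ℓX + ℓY + ℓY + M                ≤⟨ +-monoʳ-≤ (ℓX + ℓY + ℓY) M≤ℓY ⟩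
        ℓX + ℓY + ℓY + ℓY               ≡⟨ regroup ℓX ℓY ⟩
        ℓX + (ℓY + (ℓY + (ℓY + 0)))     ≤⟨ +-mono-≤ (ℓX≤dist-D (units-avoid-D i (3 + b)) runB _)
                                            (+-monoʳ-≤ ℓY (+-monoʳ-≤ ℓY (+-monoʳ-≤ ℓY z≤n))) ⟩
        dist (units i (3 + b)) (chunk (y k)) + (3 + b) * ℓY ∎
        where
        open ≤-Reasoning
        regroup : ∀ p q → p + q + q + q ≡ p + (q + (q + (q + 0)))
        regroup = solve-∀

      bonus-from-prefix : ∀ {k a b d₁ d₂ d} → k * (ℓ + ℓY) + ℓY + M ≤ d₁ + a * ℓY →
                          ℓ + ℓY ≤ d₂ + b * ℓY → d₁ + d₂ ≤ d →
                          suc k * (ℓ + ℓY) + ℓY + M ≤ d + (a + b) * ℓY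
      bonus-from-prefix {k} {a} {b} ih w c =
        ≤-trans (≤-reflexive (≡.sym (regroup (ℓ + ℓY) (k * (ℓ + ℓY)) ℓY M))) (add-bounds {a = a} {b} {ℓY} ih w c)
        where
        regroup : ∀ L kL y m → L + (kL + y + m) ≡ L + kL + y + m
        regroup = solve-∀

      bonus-from-window : ∀ {k a b d₁ d₂ d} → k * (ℓ + ℓY) + ℓY ≤ d₁ + a * ℓY →
                          ℓ + ℓY + M ≤ d₂ + b * ℓY → d₁ + d₂ ≤ d →
                          suc k * (ℓ + ℓY) + ℓY + M ≤ d + (a + b) * ℓY
      bonus-from-window {k} {a} {b} ih w c =
        ≤-trans (≤-reflexive (≡.sym (regroup (ℓ + ℓY) (k * (ℓ + ℓY)) ℓY M))) (add-bounds {a = a} {b} {ℓY} ih w c)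
        where
        regroup : ∀ L kL y m → L + m + (kL + y) ≡ L + kL + y + m
        regroup = solve-∀

      prefix-bound : ∀ k u → k * (ℓ + ℓY) + ℓY ≤ dist (units 0 u) (prefixY k) + u * ℓY
      prefix-bound zero zero = begin
        ℓY                                     ≡⟨ |y| 0 ⟨
        length (y 0)                           ≤⟨ length≤dist-syms (y 0) (Allₚ.++⁺ CAB-avoids-sym []) ⟩
        dist (units 0 0) (map sym (y 0))       ≤⟨ m≤m+n _ 0 ⟩
        dist (units 0 0) (map sym (y 0)) + 0   ∎
        where open ≤-Reasoning
      prefix-bound zero (suc u) = ≤-trans (m≤m+n ℓY (u * ℓY)) (m≤n+m _ (dist (units 0 (suc u)) (map sym (y 0))))
      prefix-bound (suc k) u with prefix-split k u
      ... | a , b , refl , c = ≤-trans (≤-reflexive (+-assoc (ℓ + ℓY) _ ℓY))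
        (add-bounds {a = a} {b} {ℓY} (prefix-bound k a) (window a b (suc k)) c)

      -- Once the prefix has more blocks of X than gadgets, a block of Y can face the block of X
      -- with its own index, and only then does the bound grow by M.
      prefix-bound⁺ : ∀ k u → k < u → k * (ℓ + ℓY) + ℓY + M ≤ dist (units 0 u) (prefixY k) + u * ℓY
      prefix-bound⁺ zero (suc zero) _ rewrite ++-identityʳ (unit (x 0)) = begin
        ℓY + M                     ≤⟨ +-monoʳ-≤ ℓY (M≤dist⁺ 0) ⟩
        ℓY + dist⁺ (x 0) (y 0)     ≤⟨ +-monoʳ-≤ ℓY (dist⁺-≤-padded (x 0) (y 0) CAB-avoids-sym CAB-avoids-sym) ⟩
        ℓY + d                     ≡⟨ trans (+-comm ℓY d) (cong (d +_) (≡.sym (+-identityʳ ℓY))) ⟩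
        d + (ℓY + 0)               ∎
        where
        open ≤-Reasoning
        d = dist (CAB ++ map sym (x 0) ++ CAB) (map sym (y 0))
      prefix-bound⁺ zero (suc (suc u)) _ =
        ≤-trans (+-monoʳ-≤ ℓY (≤-trans M≤ℓY (m≤m+n ℓY (u * ℓY))))
                (m≤n+m _ (dist (units 0 (suc (suc u))) (map sym (y 0))))
      prefix-bound⁺ (suc k) u k<u with prefix-split k u
      ... | a , zero , refl , c = bonus-from-prefix {k} {a} {0}
        (prefix-bound⁺ k a (<-trans (n<1+n k) (subst (suc k <_) (+-identityʳ a) k<u))) (window a 0 (suc k)) c
      ... | a , suc zero , refl , c = bonus-from-prefix {k} {a} {1}
        (prefix-bound⁺ k a (subst (k <_) (+-identityʳ a) (suc<+suc k a 0 k<u))) (window a 1 (suc k)) c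
      ... | a , suc (suc zero) , refl , c
        with m≤n⇒m<n∨m≡n (m<1+n⇒m≤n (subst (k <_) (+-comm a 1) (suc<+suc k a 1 k<u)))
      ...   | inj₁ k<a  = bonus-from-prefix {k} {a} {2} (prefix-bound⁺ k a k<a) (window a 2 (suc k)) c
      ...   | inj₂ refl = bonus-from-window {k} {k} {2} (prefix-bound k k) (window-aligned k) c
      prefix-bound⁺ (suc k) u k<u | a , suc (suc (suc b)) , refl , c =
        bonus-from-window {k} {a} {3 + b} (prefix-bound k a) (window-wide a b (suc k)) c

      lower-bound : ∀ m → m * ℓ + M ≤ dist (units 0 (suc m)) (prefixY m)
      lower-bound m = +-cancelʳ-≤ (suc m * ℓY) (m * ℓ + M) _
        (≤-trans (≤-reflexive (regroup m ℓ ℓY M)) (prefix-bound⁺ m (suc m) (n<1+n m)))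
        where
        regroup : ∀ m l y M → m * l + M + (y + m * y) ≡ m * (l + y) + y + M
        regroup = solve-∀

      prefixY≡ : ∀ k → prefixY k ≡ map sym (y 0) ++ concatFrom (chunk ∘ y) 1 k
      prefixY≡ zero    = ≡.sym (++-identityʳ _)
      prefixY≡ (suc k) = begin
        prefixY k ++ chunk (y (suc k))
          ≡⟨ cong (_++ chunk (y (suc k))) (prefixY≡ k) ⟩
        (map sym (y 0) ++ concatFrom (chunk ∘ y) 1 k) ++ chunk (y (suc k))
          ≡⟨ ++-assoc (map sym (y 0)) _ _ ⟩
        map sym (y 0) ++ concatFrom (chunk ∘ y) 1 k ++ chunk (y (suc k))
          ≡⟨ cong (map sym (y 0) ++_) (concatFrom-snoc (chunk ∘ y) 1 k) ⟨
        map sym (y 0) ++ concatFrom (chunk ∘ y) 1 (suc k) ∎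
        where open ≡-Reasoning

    module Instance (m : ℕ) (Xs : Fin (suc m) → Vec Σ ℓX) (Ys : Fin (suc m) → Vec Σ ℓY) where

      cost : Fin (suc m) → ℕ
      cost i = dist⁺ (toList (Xs i)) (toList (Ys i))

      -- Indices beyond m wrap around, which makes the hypotheses of LowerBound hold for every index.
      x y : ℕ → List Σ
      x k = toList (Xs (k mod suc m))
      y k = toList (Ys (k mod suc m))

      min≤ℓY : minℕ cost ≤ ℓY
      min≤ℓY = ≤-trans (minℕ-≤ cost zero)
        (≤-trans (dist⁺-≤-length (toList (Xs zero)) (toList (Ys zero))) (≤-reflexive (length-toList (Ys zero))))

      open LowerBound x y (minℕ cost) min≤ℓY (length-toList ∘ Ys ∘ (_mod suc m)) (minℕ-≤ cost ∘ (_mod suc m)) public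

      units≡ : units 0 (suc m) ≡ runC ++ bigX m Xs Ys ++ runB
      units≡ = begin
        CAB ++ concatFrom (unit ∘ block) 1 (suc m)
          ≡⟨ cong (CAB ++_) (concatFrom-shift (unit ∘ block) 0 (suc m)) ⟩
        CAB ++ concatFrom (unit ∘ x) 0 (suc m)
          ≡⟨ cong (CAB ++_) (concatFrom-tabulate (unit ∘ x) (λ j → g j ++ runB) agree) ⟩
        CAB ++ concat (tabulate (λ j → g j ++ runB))
          ≡⟨ trans (++-assoc runC _ _) (cong (runC ++_) (++-assoc runA runB _)) ⟩
        runC ++ runA ++ runB ++ concat (tabulate (λ j → g j ++ runB))
          ≡⟨ cong (λ R → runC ++ runA ++ R) (concat-tabulate-rotate g runB) ⟨
        runC ++ runA ++ concat (tabulate (λ j → runB ++ g j)) ++ runB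
          ≡⟨ cong (runC ++_) (++-assoc runA _ runB) ⟨
        runC ++ bigX m Xs Ys ++ runB ∎
        where
        open ≡-Reasoning
        g : Fin (suc m) → List (Ext Σ)
        g j = map sym (toList (Xs j)) ++ runC ++ runA
        agree : ∀ j → unit (x (toℕ j)) ≡ g j ++ runB
        agree j = trans (cong (λ i → unit (toList (Xs i))) (toℕ-mod j))
          (solve 4 (λ s c a b → s ⊕ c ⊕ a ⊕ b ⊜ (s ⊕ c ⊕ a) ⊕ b) refl (map sym (toList (Xs j))) runC runA runB)

      prefixY≡bigY : prefixY m ≡ bigY m Xs Ys
      prefixY≡bigY = begin
        prefixY m
          ≡⟨ prefixY≡ m ⟩
        map sym (y 0) ++ concatFrom (chunk ∘ y) 1 m
          ≡⟨ cong₂ _++_ (cong (λ i → map sym (toList (Ys i))) (toℕ-mod zero)) (concatFrom-shift (chunk ∘ y) 0 m) ⟩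
        map sym (toList (Ys zero)) ++ concatFrom (chunk ∘ y ∘ suc) 0 m
          ≡⟨ cong (map sym (toList (Ys zero)) ++_) (concatFrom-tabulate (chunk ∘ y ∘ suc) _ agree) ⟩
        bigY m Xs Ys ∎
        where
        open ≡-Reasoning
        agree : ∀ j → chunk (y (suc (toℕ j))) ≡ chunk (toList (Ys (suc j)))
        agree j = cong (λ i → chunk (toList (Ys i))) (toℕ-mod (suc j))

    dist-bigX-bigY : ∀ m Xs Ys → dist (bigX m Xs Ys) (bigY m Xs Ys) ≡ m * ℓ + minℕ (Instance.cost m Xs Ys)
    dist-bigX-bigY m Xs Ys = ≤-antisym upper lower
      where
      open Instance m Xs Ys
      upper : dist (bigX m Xs Ys) (bigY m Xs Ys) ≤ m * ℓ + minℕ cost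
      upper with minℕ-attained cost
      ... | i , min≡ = ≤-trans (upper-bound m Xs Ys i) (≤-reflexive (cong (m * ℓ +_) (≡.sym min≡)))
      lower : m * ℓ + minℕ cost ≤ dist (bigX m Xs Ys) (bigY m Xs Ys)
      lower = begin
        m * ℓ + minℕ cost                                         ≤⟨ lower-bound m ⟩
        dist (units 0 (suc m)) (prefixY m)                        ≡⟨ cong₂ dist units≡ prefixY≡bigY ⟩
        dist (runC ++ bigX m Xs Ys ++ runB) (bigY m Xs Ys)        ≤⟨ dist-++ˡ-≤ runC _ (bigY m Xs Ys) ⟩
        dist (bigX m Xs Ys ++ runB) (bigY m Xs Ys)                ≤⟨ dist-++ʳ-≤ (bigX m Xs Ys) runB (bigY m Xs Ys) ⟩
        dist (bigX m Xs Ys) (bigY m Xs Ys)                        ∎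
        where open ≤-Reasoning

  module Edit {E : Set} (_≟_ : DecidableEquality E) (a : ℕ) where

    open Distance _≟_ (a + a) using (dist; mismatch; dist-[]ˡ)

    edit : List E → List E → ℕ
    edit []       ys       = a * length ys
    edit (x ∷ xs) []       = a * length (x ∷ xs)
    edit (x ∷ xs) (y ∷ ys) = (edit xs ys + mismatch x y) ⊓ ((edit xs (y ∷ ys) + a) ⊓ (edit (x ∷ xs) ys + a))

    -- ED charges a per deletion and insertion, dist charges 0 per deletion and 2a per insertion.
    edit≡dist : ∀ X Y → edit X Y + a * length Y ≡ dist X Y + a * length X
    edit≡dist []       ys       = begin
      a * length ys + a * length ys  ≡⟨ *-distribʳ-+ (length ys) a a ⟨
      (a + a) * length ys            ≡⟨ dist-[]ˡ ys ⟨
      dist [] ys                     ≡⟨ +-identityʳ _ ⟨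
      dist [] ys + 0                 ≡⟨ cong (dist [] ys +_) (*-zeroʳ a) ⟨
      dist [] ys + a * 0             ∎
      where open ≡-Reasoning
    edit≡dist (x ∷ xs) []       = trans (cong (a * length (x ∷ xs) +_) (*-zeroʳ a)) (+-comm _ 0)
    edit≡dist (x ∷ xs) (y ∷ ys) = begin
      (e₁ + s) ⊓ ((e₂ + a) ⊓ (e₃ + a)) + a * suc ly
        ≡⟨ +-distribʳ-⊓₃ (a * suc ly) (e₁ + s) (e₂ + a) (e₃ + a) ⟩
      (e₁ + s + a * suc ly) ⊓ ((e₂ + a + a * suc ly) ⊓ (e₃ + a + a * suc ly))
        ≡⟨ cong₂ _⊓_ (sub (edit≡dist xs ys))
                     (cong₂ _⊓_ (del (edit≡dist xs (y ∷ ys))) (ins (edit≡dist (x ∷ xs) ys))) ⟩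
      (d₁ + s + a * suc lx) ⊓ ((d₂ + a * suc lx) ⊓ (d₃ + (a + a) + a * suc lx))
        ≡⟨ +-distribʳ-⊓₃ (a * suc lx) (d₁ + s) d₂ (d₃ + (a + a)) ⟨
      dist (x ∷ xs) (y ∷ ys) + a * suc lx ∎
      where
      open ≡-Reasoning
      lx = length xs
      ly = length ys
      s = mismatch x y
      e₁ = edit xs ys
      e₂ = edit xs (y ∷ ys)
      e₃ = edit (x ∷ xs) ys
      d₁ = dist xs ys
      d₂ = dist xs (y ∷ ys)
      d₃ = dist (x ∷ xs) ys
      r₁ : ∀ e s a l → e + s + a * suc l ≡ e + a * l + (s + a)
      r₁ = solve-∀
      r₂ : ∀ e a l → e + a * suc l ≡ e + a * l + a
      r₂ = solve-∀
      r₃ : ∀ e a l → e + a + a * suc l ≡ e + a * l + (a + a)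
      r₃ = solve-∀
      sub : e₁ + a * ly ≡ d₁ + a * lx → e₁ + s + a * suc ly ≡ d₁ + s + a * suc lx
      sub ih = trans (r₁ e₁ s a ly) (trans (cong (_+ (s + a)) ih) (≡.sym (r₁ d₁ s a lx)))
      del : e₂ + a * suc ly ≡ d₂ + a * lx → e₂ + a + a * suc ly ≡ d₂ + a * suc lx
      del ih = trans (xy∙z≈xz∙y e₂ a _) (trans (cong (_+ a) ih) (≡.sym (r₂ d₂ a lx)))
      ins : e₃ + a * ly ≡ d₃ + a * suc lx → e₃ + a + a * suc ly ≡ d₃ + (a + a) + a * suc lx
      ins ih = trans (r₃ e₃ a ly) (trans (cong (_+ (a + a)) ih) (xy∙z≈xz∙y d₃ _ (a + a)))

  module Scaling (a′ : ℕ) where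

    open ℤ using (+_)

    a : ℕ
    a = suc a′

    ⟦_⟧ : ℕ → ℚ
    ⟦ n ⟧ = + n / a

    /-cross : ∀ i j d e → i ℤ.* + suc e ≡ j ℤ.* + suc d → i / suc d ≡ j / suc e
    /-cross i j d e eq = ℚₚ.fromℚᵘ-cong {mkℚᵘ i d} {mkℚᵘ j e} (*≡* eq)

    /-+ : ∀ i j d e → i / suc d ℚ.+ j / suc e ≡ ℚ.fromℚᵘ (mkℚᵘ i d ℚᵘ.+ mkℚᵘ j e)
    /-+ i j d e = trans (≡.sym (ℚₚ.fromℚᵘ-toℚᵘ _)) (ℚₚ.fromℚᵘ-cong (ℚᵘₚ.≃-trans
      (ℚₚ.toℚᵘ-homo-+ (i / suc d) (j / suc e))
      (ℚᵘₚ.+-cong (ℚₚ.toℚᵘ-fromℚᵘ (mkℚᵘ i d)) (ℚₚ.toℚᵘ-fromℚᵘ (mkℚᵘ j e)))))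

    ⟦⟧-+ : ∀ p q → ⟦ p + q ⟧ ≡ ⟦ p ⟧ ℚ.+ ⟦ q ⟧
    ⟦⟧-+ p q = ≡.sym (trans (/-+ (+ p) (+ q) a′ a′)
                            (/-cross (+ p ℤ.* + a ℤ.+ + q ℤ.* + a) (+ (p + q)) (pred (a * a)) a′ numerators))
      where
      ring : ∀ p q a → (p ℤ.* a ℤ.+ q ℤ.* a) ℤ.* a ≡ (p ℤ.+ q) ℤ.* (a ℤ.* a)
      ring = ℤ-solve-∀
      numerators : (+ p ℤ.* + a ℤ.+ + q ℤ.* + a) ℤ.* + a ≡ + (p + q) ℤ.* + (a * a)
      numerators = trans (ring (+ p) (+ q) (+ a)) (≡.sym (cong₂ ℤ._*_ (ℤₚ.pos-+ p q) (ℤₚ.pos-* a a)))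

    ⟦a⟧≡1 : ⟦ a ⟧ ≡ 1ℚ
    ⟦a⟧≡1 = /-cross (+ a) (+ 1) a′ 0 (cong +_ (*-comm a 1))

    ⟦0⟧≡0 : ⟦ 0 ⟧ ≡ 0ℚ
    ⟦0⟧≡0 = ℚₚ.0/n≡0 a

    ⟦a*⟧ : ∀ k → ⟦ a * k ⟧ ≡ + k / 1
    ⟦a*⟧ k = /-cross (+ (a * k)) (+ k) a′ 0
      (trans (ℤₚ.*-identityʳ (+ (a * k))) (trans (cong +_ (*-comm a k)) (ℤₚ.pos-* k a)))

    ⟦⟧-mono-≤ : ∀ {p q} → p ≤ q → ⟦ p ⟧ ℚ.≤ ⟦ q ⟧
    ⟦⟧-mono-≤ {p} {q} p≤q = ℚₚ.toℚᵘ-cancel-≤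
      (ℚᵘₚ.≤-respʳ-≃ (ℚᵘₚ.≃-sym (ℚₚ.toℚᵘ-fromℚᵘ (mkℚᵘ (+ q) a′)))
        (ℚᵘₚ.≤-respˡ-≃ (ℚᵘₚ.≃-sym (ℚₚ.toℚᵘ-fromℚᵘ (mkℚᵘ (+ p) a′))) (*≤* cross)))
      where
      cross : + p ℤ.* + a ℤ.≤ + q ℤ.* + a
      cross = subst₂ ℤ._≤_ (ℤₚ.pos-* p a) (ℤₚ.pos-* q a) (ℤ.+≤+ (*-monoˡ-≤ a p≤q))

    ⟦⟧-⊓ : ∀ p q → ⟦ p ⊓ q ⟧ ≡ ⟦ p ⟧ ℚ.⊓ ⟦ q ⟧
    ⟦⟧-⊓ p q with ≤-total p q
    ... | inj₁ p≤q = trans (cong ⟦_⟧ (m≤n⇒m⊓n≡m p≤q)) (≡.sym (ℚₚ.p≤q⇒p⊓q≡p (⟦⟧-mono-≤ p≤q)))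
    ... | inj₂ q≤p = trans (cong ⟦_⟧ (m≥n⇒m⊓n≡n q≤p)) (≡.sym (ℚₚ.p≥q⇒p⊓q≡q (⟦⟧-mono-≤ q≤p)))

    minFin≡⟦minℕ⟧ : ∀ {m} (g : Fin (suc m) → ℚ) (f : Fin (suc m) → ℕ) → (∀ i → g i ≡ ⟦ f i ⟧) →
                    minFin g ≡ ⟦ minℕ f ⟧
    minFin≡⟦minℕ⟧ {zero}  g f g≡ = g≡ zero
    minFin≡⟦minℕ⟧ {suc m} g f g≡ =
      trans (cong₂ ℚ._⊓_ (g≡ zero) (minFin≡⟦minℕ⟧ (g ∘ suc) (f ∘ suc) (g≡ ∘ suc)))
            (≡.sym (⟦⟧-⊓ (f zero) (minℕ (f ∘ suc))))

    module _ {E : Set} (_≟_ : DecidableEquality E) where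

      open Distance _≟_ (a + a) using (dist; mismatch)
      open Edit _≟_ a

      subCost≡⟦mismatch⟧ : ∀ x y → subCost _≟_ a x y ≡ ⟦ mismatch x y ⟧
      subCost≡⟦mismatch⟧ x y with x ≟ y
      ... | yes _ = ≡.sym ⟦0⟧≡0
      ... | no _  = refl

      ED≡⟦edit⟧ : ∀ X Y → ED _≟_ a X Y ≡ ⟦ edit X Y ⟧
      ED≡⟦edit⟧ []       ys       = ≡.sym (⟦a*⟧ (length ys))
      ED≡⟦edit⟧ (x ∷ xs) []       = ≡.sym (⟦a*⟧ (length (x ∷ xs)))
      ED≡⟦edit⟧ (x ∷ xs) (y ∷ ys) = begin
        (ED _≟_ a xs ys ℚ.+ subCost _≟_ a x y) ℚ.⊓
          ((ED _≟_ a xs (y ∷ ys) ℚ.+ 1ℚ) ℚ.⊓ (ED _≟_ a (x ∷ xs) ys ℚ.+ 1ℚ))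
          ≡⟨ cong₂ ℚ._⊓_ (cong₂ ℚ._+_ (ED≡⟦edit⟧ xs ys) (subCost≡⟦mismatch⟧ x y))
                        (cong₂ ℚ._⊓_ (cong₂ ℚ._+_ (ED≡⟦edit⟧ xs (y ∷ ys)) (≡.sym ⟦a⟧≡1))
                                     (cong₂ ℚ._+_ (ED≡⟦edit⟧ (x ∷ xs) ys) (≡.sym ⟦a⟧≡1))) ⟩
        (⟦ e₁ ⟧ ℚ.+ ⟦ mismatch x y ⟧) ℚ.⊓ ((⟦ e₂ ⟧ ℚ.+ ⟦ a ⟧) ℚ.⊓ (⟦ e₃ ⟧ ℚ.+ ⟦ a ⟧))
          ≡⟨ cong₂ ℚ._⊓_ (⟦⟧-+ e₁ (mismatch x y)) (cong₂ ℚ._⊓_ (⟦⟧-+ e₂ a) (⟦⟧-+ e₃ a)) ⟨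
        ⟦ e₁ + mismatch x y ⟧ ℚ.⊓ (⟦ e₂ + a ⟧ ℚ.⊓ ⟦ e₃ + a ⟧)
          ≡⟨ trans (⟦⟧-⊓ (e₁ + mismatch x y) ((e₂ + a) ⊓ (e₃ + a)))
                   (cong (⟦ e₁ + mismatch x y ⟧ ℚ.⊓_) (⟦⟧-⊓ (e₂ + a) (e₃ + a))) ⟨
        ⟦ edit (x ∷ xs) (y ∷ ys) ⟧ ∎
        where
        open ≡-Reasoning
        e₁ = edit xs ys
        e₂ = edit xs (y ∷ ys)
        e₃ = edit (x ∷ xs) ys

      Dₐ≡⟦dist⟧ : ∀ X Y → Dₐ _≟_ a X Y ≡ ⟦ dist X Y ⟧
      Dₐ≡⟦dist⟧ X Y = begin
        ED _≟_ a X Y ℚ.+ (+ ly ℤ.- + lx) / 1   ≡⟨ cong (ℚ._+ ((+ ly ℤ.- + lx) / 1)) (ED≡⟦edit⟧ X Y) ⟩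
        ⟦ edit X Y ⟧ ℚ.+ (+ ly ℤ.- + lx) / 1   ≡⟨ /-+ (+ edit X Y) (+ ly ℤ.- + lx) a′ 0 ⟩
        numerator / (a * 1)                    ≡⟨ /-cross numerator (+ dist X Y) (pred (a * 1)) a′ numerators ⟩
        ⟦ dist X Y ⟧                           ∎
        where
        open ≡-Reasoning
        lx = length X
        ly = length Y
        shift : + edit X Y ℤ.+ + a ℤ.* + ly ≡ + dist X Y ℤ.+ + a ℤ.* + lx
        shift = begin
          + edit X Y ℤ.+ + a ℤ.* + ly       ≡⟨ cong (λ t → + edit X Y ℤ.+ t) (ℤₚ.pos-* a ly) ⟨
          + edit X Y ℤ.+ + (a * ly)         ≡⟨ ℤₚ.pos-+ (edit X Y) (a * ly) ⟨
          + (edit X Y + a * ly)             ≡⟨ cong +_ (edit≡dist X Y) ⟩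
          + (dist X Y + a * lx)             ≡⟨ ℤₚ.pos-+ (dist X Y) (a * lx) ⟩
          + dist X Y ℤ.+ + (a * lx)         ≡⟨ cong (λ t → + dist X Y ℤ.+ t) (ℤₚ.pos-* a lx) ⟩
          + dist X Y ℤ.+ + a ℤ.* + lx       ∎
        r₁ : ∀ e y x a → (e ℤ.* + 1 ℤ.+ (y ℤ.- x) ℤ.* a) ℤ.* a ≡ ((e ℤ.+ a ℤ.* y) ℤ.- a ℤ.* x) ℤ.* a
        r₁ = ℤ-solve-∀
        r₂ : ∀ d x a → ((d ℤ.+ a ℤ.* x) ℤ.- a ℤ.* x) ℤ.* a ≡ d ℤ.* (a ℤ.* + 1)
        r₂ = ℤ-solve-∀
        numerator = + edit X Y ℤ.* + 1 ℤ.+ (+ ly ℤ.- + lx) ℤ.* + a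
        numerators : numerator ℤ.* + a ≡ + dist X Y ℤ.* + (a * 1)
        numerators = begin
          numerator ℤ.* + a                                       ≡⟨ r₁ (+ edit X Y) (+ ly) (+ lx) (+ a) ⟩
          ((+ edit X Y ℤ.+ + a ℤ.* + ly) ℤ.- + a ℤ.* + lx) ℤ.* + a
                                                                  ≡⟨ cong (λ t → (t ℤ.- + a ℤ.* + lx) ℤ.* + a) shift ⟩
          ((+ dist X Y ℤ.+ + a ℤ.* + lx) ℤ.- + a ℤ.* + lx) ℤ.* + a ≡⟨ r₂ (+ dist X Y) (+ lx) (+ a) ⟩
          + dist X Y ℤ.* (+ a ℤ.* + 1)                            ≡⟨ cong (λ t → + dist X Y ℤ.* t) (ℤₚ.pos-* a 1) ⟨
          + dist X Y ℤ.* + (a * 1)                                ∎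


open ScaledDistance using (minℕ; module Reduction; module Scaling)

open import Data.Nat as ℕ using (ℕ; suc; NonZero; _≤_; _<_; _*_; z≤n; s≤s)
open import Data.Integer using (+_)
open import Data.Rational using (ℚ; _/_; _+_)
open import Data.Fin using (Fin)
open import Data.Vec using (Vec; toList)
open import Relation.Binary.Definitions using (DecidableEquality)
open import Relation.Binary.PropositionalEquality using (_≡_; cong; module ≡-Reasoning)
open import Data.List using (_++_; map; length)

lemma29 : (Σ : Set) (_≟_ : DecidableEquality Σ)
    (a : ℕ) .{{_ : NonZero a}} (m ℓX ℓY : ℕ) → suc m ≤ a → 0 < ℓX → 0 < ℓY →
    (Xs : Fin (suc m) → Vec Σ ℓX) (Ys : Fin (suc m) → Vec Σ ℓY) →
    DₐE _≟_ a (Construction.bigX m ℓX ℓY Xs Ys) (Construction.bigY m ℓX ℓY Xs Ys)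
      ≡ (+ (m * (ℓX ℕ.+ ℓY)) / a)
        + minFin (λ i → D⁺ _≟_ a (toList (Xs i)) (toList (Ys i)))
lemma29 Σ _≟_ (suc a′) m ℓX ℓY _ _ _ Xs Ys = begin
  DₐE _≟_ a (bigX m Xs Ys) (bigY m Xs Ys)   ≡⟨ Dₐ≡⟦dist⟧ (_≟E_ _≟_) (bigX m Xs Ys) (bigY m Xs Ys) ⟩
  ⟦ dist (bigX m Xs Ys) (bigY m Xs Ys) ⟧     ≡⟨ cong ⟦_⟧ (dist-bigX-bigY m Xs Ys) ⟩
  ⟦ m * ℓ ℕ.+ minℕ cost ⟧                   ≡⟨ ⟦⟧-+ (m * ℓ) (minℕ cost) ⟩
  ⟦ m * ℓ ⟧ + ⟦ minℕ cost ⟧                 ≡⟨ cong (λ q → ⟦ m * ℓ ⟧ + q) (minFin≡⟦minℕ⟧ D⁺s cost D⁺≡) ⟨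
  ⟦ m * ℓ ⟧ + minFin D⁺s                    ∎
  where
  open ≡-Reasoning
  open Scaling a′
  open Reduction _≟_ (a ℕ.+ a) (s≤s z≤n) ℓX ℓY
  open Instance m Xs Ys using (cost)
  D⁺s : Fin (suc m) → ℚ
  D⁺s i = D⁺ _≟_ a (toList (Xs i)) (toList (Ys i))
  D⁺≡ : ∀ i → D⁺s i ≡ ⟦ cost i ⟧
  D⁺≡ i = Dₐ≡⟦dist⟧ (_≟E_ _≟_) (dollars k ++ map sym X ++ dollars k) (map sym Y)
    where
    X = toList (Xs i)
    Y = toList (Ys i)
    k = length Y
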